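{- Let $n$ and $k$ be positive integers, let $\lambda^\circ=((n),\ldots,(n))$ be the $k$-tuple of single-row partitions of length $n$, let $\mu$ be a partition of weight $kn$, and let $d$ be a diagonal vector such that the diagonal class $D_{\lambda^\circ,\mu}(d)$ has at least $2$ elements. Then for every primitive $k$-th root of unity $\zeta$, $$\widetilde{I}_{\lambda^\circ,\mu}(\zeta;d)=0.$$
   Context: For a $k$-tuple $T^\circ=(T^{\circ_1},\ldots,T^{\circ_k})$ of semi-standard Young tableaux with positive integer entries, the weight of $T^\circ$ is the composition $(\mu_1,\mu_2,\ldots)$ where $\mu_i$ is the total number of entries equal to $i$. $\mathrm{Tab}_{\lambda^\circ,\mu}$ denotes the set of such $k$-tuples with $T^{\circ_j}$ of shape $\lambda^{\circ_j}$ and weight $\mu$. For a cell $s$ of $T^\circ$: $\mathrm{pos}(s)$ is the index $j$ with $s$ in $T^{\circ_j}$; $T^\circ(s)$ is its label; $\mathrm{row}(s)$, $\mathrm{col}(s)$ are its row and column in $T^{\circ_{\mathrm{pos}(s)}}$; $\mathrm{diag}(s)=\mathrm{col}(s)-\mathrm{row}(s)$. Inversions: a pair of cells $(s,t)$ is an inversion of $T^\circ$ if (1) either $\mathrm{diag}(s)=\mathrm{diag}(t)$ and $\mathrm{pos}(s)<\mathrm{pos}(t)$, or $\mathrm{diag}(s)=\mathrm{diag}(t)-1$ and $\mathrm{pos}(s)>\mathrm{pos}(t)$; (2) $\mathrm{row}(s)\le\mathrm{row}(t)$; (3) $T^\circ(t)<T^\circ(s)<T^\circ(t^\uparrow)$,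 where $t^\uparrow$ is the cell directly above $t$ and $T^\circ(t^\uparrow)=\infty$ if there is no such cell. $\mathrm{Inv}(T^\circ)$ is the number of inversions. Diagonal classes: for $\lambda^\circ=((n),\ldots,(n))$ and $i\in\{0,\ldots,n-1\}$, let $d_i$ be the multiset $\{T^\circ(s): \mathrm{diag}(s)=i\}$; the diagonal vector of $T^\circ$ is $(d_0,\ldots,d_{n-1})$. For a diagonal vector $d$, $D_{\lambda^\circ,\mu}(d)$ is the set of $T^\circ\in\mathrm{Tab}_{\lambda^\circ,\mu}$ with diagonal vector $d$, and $\widetilde{I}_{\lambda^\circ,\mu}(q;d)=\sum_{T^\circ\in D_{\lambda^\circ,\mu}(d)} q^{\mathrm{Inv}(T^\circ)}$. -}

module Defs where

open import Level using (Level)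
open import Data.Nat.ListAction using (sum)
open import Data.Bool using (Bool; true; false; _∧_; _∨_; if_then_else_)
open import Data.Nat using (ℕ; zero; suc; _≤_; _<_; _≡ᵇ_; _<ᵇ_)
open import Data.Fin using (Fin; toℕ)
open import Data.List using (List; []; _∷_; map; length; allFin; cartesianProduct; concatMap)
open import Data.List.Relation.Unary.Linked using (Linked)
open import Data.List.Relation.Binary.Permutation.Propositional using (_↭_)
open import Data.Vec using (Vec; lookup)
open import Data.Product using (_×_; _,_; proj₁; proj₂)
open import Data.Sum using (_⊎_)
open import Relation.Binary.PropositionalEquality using (_≡_)
open import Relation.Nullary using (¬_)
open import Algebra.Bundles using (CommutativeRing)

-- A k-tuple of single-row tableaux of shape ((n),...,(n)):
-- T lookup j gives row j (0-based index for the j-th component), whose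
-- c-th entry (0-based column c) is the label.  Labels are natural numbers
-- (required positive by IsTab).
Tab : ℕ → ℕ → Set
Tab k n = Vec (Vec ℕ n) k

label : ∀ {k n} → Tab k n → Fin k → Fin n → ℕ
label T j c = lookup (lookup T j) c

-- A cell: (pos, column), both 0-based.  Since every shape is a single row,
-- row(s) = 1 for every cell and diag(s) = col(s) - 1 = toℕ c.
Cell : ℕ → ℕ → Set
Cell k n = Fin k × Fin n

cells : (k n : ℕ) → List (Cell k n)
cells k n = cartesianProduct (allFin k) (allFin n)

-- Semi-standard (single rows: weakly increasing), positive entries.
IsSSYTTuple : ∀ {k n} → Tab k n → Set
IsSSYTTuple {k} {n} T =
  (∀ j c → 1 ≤ label T j c) ×
  (∀ j (c c' : Fin n) → toℕ c ≤ toℕ c' → label T j c ≤ label T j c')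

countLabel : ∀ {k n} → Tab k n → ℕ → ℕ
countLabel {k} {n} T m =
  sum (map (λ s → if label T (proj₁ s) (proj₂ s) ≡ᵇ m then 1 else 0) (cells k n))

-- i-th part of μ (0-based), 0 beyond its length
part : List ℕ → ℕ → ℕ
part []       _       = 0
part (x ∷ _)  zero    = x
part (_ ∷ xs) (suc i) = part xs i

HasWeight : ∀ {k n} → Tab k n → List ℕ → Set
HasWeight T μ = ∀ i → countLabel T (suc i) ≡ part μ i

IsPartition : List ℕ → ℕ → Set
IsPartition μ m = Linked (λ a b → b ≤ a) μ × Data.List.Relation.Unary.All.All (λ a → 1 ≤ a) μ × sum μ ≡ m
  where import Data.List.Relation.Unary.All

InTab : ∀ {k n} → List ℕ → Tab k n → Set
InTab μ T = IsSSYTTuple T × HasWeight T μ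

-- Inversion test for a pair of cells (s,t).
-- (1) diag s = diag t and pos s < pos t, or diag s = diag t - 1 and pos s > pos t;
-- (2) row s ≤ row t holds automatically (all cells in row 1);
-- (3) T(t) < T(s) < T(t↑) = ∞ (no cell above any cell in a single row).
isInv : ∀ {k n} → Tab k n → Cell k n → Cell k n → Bool
isInv T (js , cs) (jt , ct) =
  (((toℕ cs ≡ᵇ toℕ ct) ∧ (toℕ js <ᵇ toℕ jt)) ∨
   ((suc (toℕ cs) ≡ᵇ toℕ ct) ∧ (toℕ jt <ᵇ toℕ js)))
  ∧ (label T jt ct <ᵇ label T js cs)

Inv : ∀ {k n} → Tab k n → ℕ
Inv {k} {n} T =
  sum (concatMap (λ s → map (λ t → if isInv T s t then 1 else 0) (cells k n)) (cells k n))

-- Diagonal vector: d i is the multiset of labels on diagonal i, as a list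
-- up to permutation.
DiagonalVector : ℕ → Set
DiagonalVector n = Vec (List ℕ) n

HasDiag : ∀ {k n} → Tab k n → DiagonalVector n → Set
HasDiag {k} {n} T d = ∀ (c : Fin n) → map (λ j → label T j c) (allFin k) ↭ lookup d c

InD : ∀ {k n} → List ℕ → DiagonalVector n → Tab k n → Set
InD μ d T = InTab μ T × HasDiag T d

module _ {c ℓ : Level} (R : CommutativeRing c ℓ) where
  open CommutativeRing R

  pow : Carrier → ℕ → Carrier
  pow x zero    = 1#
  pow x (suc m) = x * pow x m

  IsIntegralDomain : Set (c Level.⊔ ℓ)
  IsIntegralDomain = (¬ (1# ≈ 0#)) × (∀ x y → x * y ≈ 0# → x ≈ 0# ⊎ y ≈ 0#)

  IsPrimitiveRoot : ℕ → Carrier → Set ℓ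
  IsPrimitiveRoot k ζ = pow ζ k ≈ 1# × (∀ j → 0 < j → j < k → ¬ (pow ζ j ≈ 1#))

  invSum : ∀ {k n} → Carrier → List (Tab k n) → Carrier
  invSum ζ []       = 0#
  invSum ζ (T ∷ Ts) = pow ζ (Inv T) + invSum ζ Ts

-- Fix two tuples in D, let cs be the last column in which the first is not
-- constant and m the least entry of that column.  All tuples in D have the same
-- multiset of entries in every column, so each column after cs is constant in
-- all of them.  When rows j and j+1 carry m and some v ≠ m in column cs,
-- exchange their tails from the largest column i ≤ cs at which both rows stay
-- weakly increasing.  This is an involution of D; it merely permutes the
-- inversions not between rows j and j+1, and between them it only changes the
-- comparison in column cs, so Inv moves by exactly one.  Bubbling the entry of
-- row 0 in column cs down through rows 1, …, k−1 with these moves gives a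
-- bijection Φ of D with Inv (Φ T) = Inv T + o if that entry is m and
-- Inv (Φ T) = Inv T − z otherwise, where o and z = k − o count the entries
-- ≠ m and = m in column cs.  Thus ζ^Inv(Φ T) = ζ^o ζ^Inv(T), so the sum S
-- satisfies S = ζ^o S with 0 < o < k, and S = 0 in a domain.

module Submission where

open import Defs
open import Level using (Level)
open import Function using (_∘_)
open import Function.Bundles using (_⇔_; mk⇔; Equivalence)
open import Data.Empty using (⊥-elim)
open import Data.Product using (_×_; _,_; proj₁; proj₂; ∃-syntax)
open Data.Product.Σ
open import Data.Sum using (_⊎_; inj₁; inj₂)
import Data.Sum as Sum
open import Data.Bool using (Bool; true; false; not; _∧_; _∨_; _xor_; if_then_else_; T)
open import Data.Bool.Properties
  using (∧-conicalˡ; ∧-conicalʳ; ∨-zeroʳ; ∧-zeroʳ; ∧-identityʳ; ∨-identityʳ; xor-comm; xor-same; ∧-comm)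
open import Data.Nat using (ℕ; zero; suc; _+_; _*_; _≤_; _<_; _≤ᵇ_; _<ᵇ_; _≡ᵇ_; z≤n; s≤s; z<s; s<s; _≤?_; _<?_; _≟_)
open import Data.Nat.Properties
  using ( ≤ᵇ⇒≤; ≤⇒≤ᵇ; <ᵇ⇒<; <⇒<ᵇ; suc-injective; 1+n≢n; 1+n≢0; +-assoc; +-comm; +-identityʳ; +-commutativeSemigroup
        ; ≤-refl; ≤-reflexive; ≤-trans; ≤-antisym; ≤-pred; <-trans; <-irrefl; <-cmp; ≤-<-trans; <-≤-trans
        ; <⇒≤; <⇒≱; ≤⇒≯; ≮⇒≥; ≰⇒>; ≤∧≢⇒<; n<1+n; n≤1+n; m<n⇒m<1+n; m≤n⇒m≤1+n; m≤m+n; m≤n+m; m<m+n; n≤0⇒n≡0)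
open import Data.Nat.ListAction using (sum)
open import Data.Nat.ListAction.Properties using (sum-++; sum-↭)
open import Data.Fin using (Fin; toℕ; fromℕ<)
import Data.Fin as Fin
open import Data.Fin.Properties using (toℕ<n; toℕ-fromℕ<)
open import Data.Vec using (Vec; []; _∷_; lookup; replicate)
import Data.Vec as Vec
open import Data.Vec.Properties using (tabulate∘lookup; tabulate-cong)
open import Data.List using (List; length; []; _∷_; map; concatMap; cartesianProduct; allFin; applyUpTo)
import Data.List as List
open import Data.List.Properties using (map-++; map-∘; map-applyUpTo)
open import Data.List.Extrema.Nat using (min; min≤xs; argmin-sel)
open import Data.List.Membership.Propositional using (_∈_)
open import Data.List.Membership.Propositional.Properties using (∈-map⁺; ∈-map⁻; ∈-applyUpTo⁺; ∈-applyUpTo⁻)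
open import Data.List.Membership.Propositional.Properties.WithK using (unique∧set⇒bag)
open import Data.List.Relation.Unary.Any using (here; there)
import Data.List.Relation.Unary.All as All
open All using (_∷_)
open import Data.List.Relation.Unary.AllPairs using ([]; _∷_)
open import Data.List.Relation.Unary.Unique.Propositional using (Unique)
open import Data.List.Relation.Binary.Permutation.Propositional using (_↭_; prep; swap; ↭-refl; module PermutationReasoning)
import Data.List.Relation.Binary.Permutation.Propositional as ↭
import Data.List.Relation.Binary.Permutation.Propositional.Properties as ↭ₚ
open import Data.List.Relation.Binary.BagAndSetEquality using (∼bag⇒↭)
open import Relation.Nullary using (¬_; yes; no)
open import Relation.Nullary.Decidable using (dec-true; dec-false)
open import Relation.Binary.Definitions using (tri<; tri≈; tri>)
open import Relation.Binary.PropositionalEquality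
  using (_≡_; _≢_; refl; sym; trans; cong; cong₂; subst; subst₂; module ≡-Reasoning)
open import Algebra.Bundles using (CommutativeRing)
open import Algebra.Properties.CommutativeSemigroup +-commutativeSemigroup using (interchange; xy∙z≈xz∙y)

𝟙 : Bool → ℕ
𝟙 b = if b then 1 else 0

module _ {m n : ℕ} where

  <ᵇ-true : m < n → (m <ᵇ n) ≡ true
  <ᵇ-true = dec-true (m <? n)

  <ᵇ-false : n ≤ m → (m <ᵇ n) ≡ false
  <ᵇ-false n≤m = dec-false (m <? n) (≤⇒≯ n≤m)

  ≤ᵇ-true : m ≤ n → (m ≤ᵇ n) ≡ true
  ≤ᵇ-true = dec-true (m ≤? n)

  ≤ᵇ-false : n < m → (m ≤ᵇ n) ≡ false
  ≤ᵇ-false n<m = dec-false (m ≤? n) (<⇒≱ n<m)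

  ≡ᵇ-true : m ≡ n → (m ≡ᵇ n) ≡ true
  ≡ᵇ-true = dec-true (m ≟ n)

  ≡ᵇ-false : m ≢ n → (m ≡ᵇ n) ≡ false
  ≡ᵇ-false = dec-false (m ≟ n)

  ≤ᵇ-true⇒≤ : (m ≤ᵇ n) ≡ true → m ≤ n
  ≤ᵇ-true⇒≤ e = ≤ᵇ⇒≤ m n (subst T (sym e) _)

  ≤ᵇ-false⇒> : (m ≤ᵇ n) ≡ false → n < m
  ≤ᵇ-false⇒> e = ≰⇒> (λ m≤n → subst T e (≤⇒≤ᵇ m≤n))

  <ᵇ-true⇒< : (m <ᵇ n) ≡ true → m < n
  <ᵇ-true⇒< e = <ᵇ⇒< m n (subst T (sym e) _)

  <ᵇ-false⇒≥ : (m <ᵇ n) ≡ false → n ≤ m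
  <ᵇ-false⇒≥ e = ≮⇒≥ (λ m<n → subst T e (<⇒<ᵇ m<n))

  𝟙<-one : m < n → 𝟙 (m <ᵇ n) ≡ 1
  𝟙<-one m<n = cong 𝟙 (<ᵇ-true m<n)

  𝟙<-zero : n ≤ m → 𝟙 (m <ᵇ n) ≡ 0
  𝟙<-zero n≤m = cong 𝟙 (<ᵇ-false n≤m)

≡ᵇ-refl : ∀ m → (m ≡ᵇ m) ≡ true
≡ᵇ-refl m = ≡ᵇ-true {m} {m} refl

∑< : ℕ → (ℕ → ℕ) → ℕ
∑< n f = sum (applyUpTo f n)

syntax ∑< n (λ i → e) = ∑[ i < n ] e

∑<-cong : ∀ n {f g : ℕ → ℕ} → (∀ i → i < n → f i ≡ g i) → ∑< n f ≡ ∑< n g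
∑<-cong zero    f≗g = refl
∑<-cong (suc n) f≗g = cong₂ _+_ (f≗g 0 z<s) (∑<-cong n (λ i i<n → f≗g (suc i) (s<s i<n)))

∑<-distrib-+ : ∀ n (f g : ℕ → ℕ) → ∑[ i < n ] (f i + g i) ≡ ∑< n f + ∑< n g
∑<-distrib-+ zero    f g = refl
∑<-distrib-+ (suc n) f g =
  trans (cong (f 0 + g 0 +_) (∑<-distrib-+ n (f ∘ suc) (g ∘ suc))) (interchange (f 0) (g 0) _ _)

∑<-zero : ∀ n → ∑[ i < n ] 0 ≡ 0
∑<-zero zero    = refl
∑<-zero (suc n) = ∑<-zero n

∑<-one : ∀ n → ∑[ i < n ] 1 ≡ n
∑<-one zero    = refl
∑<-one (suc n) = cong suc (∑<-one n)

∑<-comm : ∀ m n (f : ℕ → ℕ → ℕ) → ∑[ a < m ] ∑[ b < n ] f a b ≡ ∑[ b < n ] ∑[ a < m ] f a b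
∑<-comm zero    n f = sym (∑<-zero n)
∑<-comm (suc m) n f =
  trans (cong (∑< n (f 0) +_) (∑<-comm m n (f ∘ suc)))
        (sym (∑<-distrib-+ n (f 0) (λ b → ∑[ a < m ] f (suc a) b)))

∑<-init-last : ∀ n (f : ℕ → ℕ) → ∑< (suc n) f ≡ ∑< n f + f n
∑<-init-last zero    f = +-comm (f 0) 0
∑<-init-last (suc n) f = trans (cong (f 0 +_) (∑<-init-last n (f ∘ suc))) (sym (+-assoc (f 0) _ _))

∑<-delta : ∀ n p (g : ℕ → ℕ) → ∑[ i < n ] (if p ≡ᵇ i then g i else 0) ≡ (if p <ᵇ n then g p else 0)
∑<-delta zero    p       g = refl
∑<-delta (suc n) zero    g = trans (cong (g 0 +_) (∑<-zero n)) (+-identityʳ (g 0))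
∑<-delta (suc n) (suc p) g = ∑<-delta n p (g ∘ suc)

∑<-term-≤ : ∀ n (f : ℕ → ℕ) {a} → a < n → f a ≤ ∑< n f
∑<-term-≤ (suc n) f {zero}  _         = m≤m+n (f 0) _
∑<-term-≤ (suc n) f {suc a} (s<s a<n) = ≤-trans (∑<-term-≤ n (f ∘ suc) a<n) (m≤n+m _ (f 0))

∑<-zero⇒ : ∀ n (f : ℕ → ℕ) → ∑< n f ≡ 0 → ∀ {a} → a < n → f a ≡ 0
∑<-zero⇒ n f ∑≡0 a<n = n≤0⇒n≡0 (subst (f _ ≤_) ∑≡0 (∑<-term-≤ n f a<n))

∑<-pos⇒ : ∀ n (f : ℕ → ℕ) → 0 < ∑< n f → ∃[ a ] a < n × 0 < f a
∑<-pos⇒ (suc n) f pos with f 0 in f0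
... | suc _ = 0 , z<s , subst (0 <_) (sym f0) z<s
... | zero with ∑<-pos⇒ n (f ∘ suc) pos
...   | a , a<n , fa = suc a , s<s a<n , fa

∑<-if : ∀ n (B : Bool) (f : ℕ → ℕ) → ∑[ i < n ] (if B then f i else 0) ≡ (if B then ∑< n f else 0)
∑<-if n true  f = refl
∑<-if n false f = ∑<-zero n

∑<-differ-at : ∀ n {p} (f g : ℕ → ℕ) {u v} → p < n → (∀ b → b < n → b ≢ p → f b ≡ g b) →
               f p + u ≡ g p + v → ∑< n f + u ≡ ∑< n g + v
∑<-differ-at (suc n) {zero} f g {u} {v} _ f≗g fp+u≡gp+v = begin
  f 0 + ∑< n (f ∘ suc) + u  ≡⟨ xy∙z≈xz∙y (f 0) _ u ⟩
  f 0 + u + ∑< n (f ∘ suc)  ≡⟨ cong₂ _+_ fp+u≡gp+v (∑<-cong n (λ b b<n → f≗g (suc b) (s<s b<n) (λ ()))) ⟩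
  g 0 + v + ∑< n (g ∘ suc)  ≡⟨ xy∙z≈xz∙y (g 0) v _ ⟩
  g 0 + ∑< n (g ∘ suc) + v  ∎
  where open ≡-Reasoning
∑<-differ-at (suc n) {suc p} f g {u} {v} (s<s p<n) f≗g fp+u≡gp+v = begin
  f 0 + ∑< n (f ∘ suc) + u    ≡⟨ +-assoc (f 0) _ u ⟩
  f 0 + (∑< n (f ∘ suc) + u)  ≡⟨ cong₂ _+_ (f≗g 0 z<s (λ ()))
                                  (∑<-differ-at n (f ∘ suc) (g ∘ suc) p<n
                                     (λ b b<n b≢p → f≗g (suc b) (s<s b<n) (b≢p ∘ suc-injective)) fp+u≡gp+v) ⟩
  g 0 + (∑< n (g ∘ suc) + v)  ≡⟨ +-assoc (g 0) _ v ⟨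
  g 0 + ∑< n (g ∘ suc) + v    ∎
  where open ≡-Reasoning

transpose : ℕ → ℕ → ℕ
transpose zero    zero          = 1
transpose zero    (suc zero)    = 0
transpose zero    (suc (suc a)) = suc (suc a)
transpose (suc j) zero          = zero
transpose (suc j) (suc a)       = suc (transpose j a)

transpose-involutive : ∀ j a → transpose j (transpose j a) ≡ a
transpose-involutive zero    zero          = refl
transpose-involutive zero    (suc zero)    = refl
transpose-involutive zero    (suc (suc a)) = refl
transpose-involutive (suc j) zero          = refl
transpose-involutive (suc j) (suc a)       = cong suc (transpose-involutive j a)

data TransposeView (j : ℕ) : ℕ → ℕ → Set where
  first  : TransposeView j j (suc j)
  second : TransposeView j (suc j) j
  fixed  : ∀ {a} → a ≢ j → a ≢ suc j → TransposeView j a a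

transpose-view : ∀ j a → TransposeView j a (transpose j a)
transpose-view zero    zero          = first
transpose-view zero    (suc zero)    = second
transpose-view zero    (suc (suc a)) = fixed (λ ()) (λ ())
transpose-view (suc j) zero          = fixed (λ ()) (λ ())
transpose-view (suc j) (suc a) with transpose j a | transpose-view j a
... | _ | first         = first
... | _ | second        = second
... | _ | fixed a≢j a≢sj = fixed (a≢j ∘ suc-injective) (a≢sj ∘ suc-injective)

transpose-first : ∀ j → transpose j j ≡ suc j
transpose-first j with transpose j j | transpose-view j j
... | _ | first        = refl
... | _ | fixed j≢j _  = ⊥-elim (j≢j refl)

transpose-second : ∀ j → transpose j (suc j) ≡ j
transpose-second j with transpose j (suc j) | transpose-view j (suc j)
... | _ | second        = refl
... | _ | fixed _ sj≢sj = ⊥-elim (sj≢sj refl)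

transpose-fixed : ∀ j {a} → a ≢ j → a ≢ suc j → transpose j a ≡ a
transpose-fixed j {a} a≢j a≢sj with transpose j a | transpose-view j a
... | _ | first     = ⊥-elim (a≢j refl)
... | _ | second    = ⊥-elim (a≢sj refl)
... | _ | fixed _ _ = refl

transpose-< : ∀ {k} j {a} → suc j < k → a < k → transpose j a < k
transpose-< j {a} sj<k a<k with transpose j a | transpose-view j a
... | _ | first     = sj<k
... | _ | second    = <-trans (n<1+n j) sj<k
... | _ | fixed _ _ = a<k

transpose-≥ : ∀ {k} j {a} → suc j < k → k ≤ a → transpose j a ≡ a
transpose-≥ j sj<k k≤a =
  transpose-fixed j (λ { refl → <⇒≱ (<-trans (n<1+n j) sj<k) k≤a }) (λ { refl → <⇒≱ sj<k k≤a })

applyUpTo-transpose : ∀ {A : Set} n j (f : ℕ → A) → suc j < n → applyUpTo (f ∘ transpose j) n ↭ applyUpTo f n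
applyUpTo-transpose (suc (suc n)) zero    f _           = swap (f 1) (f 0) ↭-refl
applyUpTo-transpose (suc n)       (suc j) f (s<s sj<n) = prep (f 0) (applyUpTo-transpose n j (f ∘ suc) sj<n)

module _ (j c : ℕ) (c≢j : c ≢ j) (c≢sj : c ≢ suc j) where

  private
    j<c⇔sj<c : (j <ᵇ c) ≡ (suc j <ᵇ c)
    j<c⇔sj<c with <-cmp j c
    ... | tri< j<c _ _ = trans (<ᵇ-true j<c) (sym (<ᵇ-true (≤∧≢⇒< j<c (c≢sj ∘ sym))))
    ... | tri≈ _ j≡c _ = ⊥-elim (c≢j (sym j≡c))
    ... | tri> _ _ c<j = trans (<ᵇ-false (<⇒≤ c<j)) (sym (<ᵇ-false (m≤n⇒m≤1+n (<⇒≤ c<j))))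

    c<j⇔c<sj : (c <ᵇ j) ≡ (c <ᵇ suc j)
    c<j⇔c<sj with <-cmp c j
    ... | tri< c<j _ _ = trans (<ᵇ-true c<j) (sym (<ᵇ-true (m<n⇒m<1+n c<j)))
    ... | tri≈ _ c≡j _ = ⊥-elim (c≢j c≡j)
    ... | tri> _ _ j<c = trans (<ᵇ-false (<⇒≤ j<c)) (sym (<ᵇ-false {c} {suc j} j<c))

  transpose-<ᵇˡ : ∀ a → (transpose j a <ᵇ c) ≡ (a <ᵇ c)
  transpose-<ᵇˡ a with transpose j a | transpose-view j a
  ... | _ | first     = sym j<c⇔sj<c
  ... | _ | second    = j<c⇔sj<c
  ... | _ | fixed _ _ = refl

  transpose-<ᵇʳ : ∀ a → (c <ᵇ transpose j a) ≡ (c <ᵇ a)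
  transpose-<ᵇʳ a with transpose j a | transpose-view j a
  ... | _ | first     = sym c<j⇔c<sj
  ... | _ | second    = c<j⇔c<sj
  ... | _ | fixed _ _ = refl

lookupOr : ∀ {A : Set} {n} → A → Vec A n → ℕ → A
lookupOr d []      i       = d
lookupOr d (x ∷ v) zero    = x
lookupOr d (x ∷ v) (suc i) = lookupOr d v i

lookupOr-toℕ : ∀ {A : Set} {n} (d : A) (v : Vec A n) (i : Fin n) → lookupOr d v (toℕ i) ≡ lookup v i
lookupOr-toℕ d (x ∷ v) Fin.zero    = refl
lookupOr-toℕ d (x ∷ v) (Fin.suc i) = lookupOr-toℕ d v i

lookupOr-≥ : ∀ {A : Set} {n} (d : A) (v : Vec A n) {i} → n ≤ i → lookupOr d v i ≡ d
lookupOr-≥ d []      _         = refl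
lookupOr-≥ d (x ∷ v) (s≤s n≤i) = lookupOr-≥ d v n≤i

lookupOr-replicate : ∀ {A : Set} n (d : A) i → lookupOr d (replicate n d) i ≡ d
lookupOr-replicate zero    d i       = refl
lookupOr-replicate (suc n) d zero    = refl
lookupOr-replicate (suc n) d (suc i) = lookupOr-replicate n d i

lookupOr-tabulate : ∀ {A : Set} n (d : A) (f : ℕ → A) {i} → i < n →
                    lookupOr d (Vec.tabulate {n = n} (f ∘ toℕ)) i ≡ f i
lookupOr-tabulate (suc n) d f {zero}  _         = refl
lookupOr-tabulate (suc n) d f {suc i} (s<s i<n) = lookupOr-tabulate n d (f ∘ suc) i<n

-- A tableau read as an ℕ-indexed array that is 0 outside the k × n rectangle,
-- so that all sums below range over ℕ.
entry : ∀ {k n} → Tab k n → ℕ → ℕ → ℕ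
entry {n = n} T a b = lookupOr 0 (lookupOr (replicate n 0) T a) b

label≡entry : ∀ {k n} (T : Tab k n) r c → label T r c ≡ entry T (toℕ r) (toℕ c)
label≡entry {n = n} T r c rewrite lookupOr-toℕ (replicate n 0) T r = sym (lookupOr-toℕ 0 (lookup T r) c)

entry≡label : ∀ {k n} (T : Tab k n) {a b} (a<k : a < k) (b<n : b < n) →
              entry T a b ≡ label T (fromℕ< a<k) (fromℕ< b<n)
entry≡label T a<k b<n =
  trans (cong₂ (entry T) (sym (toℕ-fromℕ< a<k)) (sym (toℕ-fromℕ< b<n))) (sym (label≡entry T _ _))

entry-≥row : ∀ {k n} (T : Tab k n) {a} b → k ≤ a → entry T a b ≡ 0
entry-≥row {n = n} T b k≤a rewrite lookupOr-≥ (replicate n 0) T k≤a = lookupOr-replicate n 0 b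

entry-≥col : ∀ {k n} (T : Tab k n) a {b} → n ≤ b → entry T a b ≡ 0
entry-≥col {n = n} T a n≤b = lookupOr-≥ 0 (lookupOr (replicate n 0) T a) n≤b

tabulateEntries : ∀ {k n} → (ℕ → ℕ → ℕ) → Tab k n
tabulateEntries f = Vec.tabulate (λ r → Vec.tabulate (λ c → f (toℕ r) (toℕ c)))

entry-tabulateEntries : ∀ {k n} (f : ℕ → ℕ → ℕ) {a b} → a < k → b < n →
                        entry {k} {n} (tabulateEntries f) a b ≡ f a b
entry-tabulateEntries {k} {n} f {a} {b} a<k b<n =
  trans (cong (λ row → lookupOr 0 row b) (lookupOr-tabulate k (replicate n 0) (λ a → Vec.tabulate (f a ∘ toℕ)) a<k))
        (lookupOr-tabulate n 0 (f a) b<n)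

Tab-ext : ∀ {k n} (T U : Tab k n) → (∀ a b → a < k → b < n → entry T a b ≡ entry U a b) → T ≡ U
Tab-ext T U T≗U = trans (sym (tabulate∘lookup T)) (trans (tabulate-cong rows) (tabulate∘lookup U))
  where
  rows : ∀ r → lookup T r ≡ lookup U r
  rows r = trans (sym (tabulate∘lookup (lookup T r)))
             (trans (tabulate-cong (λ c → trans (label≡entry T r c)
                                        (trans (T≗U _ _ (toℕ<n r) (toℕ<n c)) (sym (label≡entry U r c)))))
                    (tabulate∘lookup (lookup U r)))

sum-concatMap : ∀ {A : Set} (f : A → List ℕ) xs → sum (concatMap f xs) ≡ sum (map (sum ∘ f) xs)
sum-concatMap f []       = refl
sum-concatMap f (x ∷ xs) = trans (sum-++ (f x) _) (cong (sum (f x) +_) (sum-concatMap f xs))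

sum-map-cartesianProduct : ∀ {A B : Set} (xs : List A) (ys : List B) (h : A → B → ℕ) →
  sum (map (λ s → h (proj₁ s) (proj₂ s)) (cartesianProduct xs ys)) ≡ sum (map (λ x → sum (map (h x) ys)) xs)
sum-map-cartesianProduct []       ys h = refl
sum-map-cartesianProduct {A} {B} (x ∷ xs) ys h =
  trans (cong sum (map-++ h′ (map (x ,_) ys) (cartesianProduct xs ys)))
        (trans (sum-++ (map h′ (map (x ,_) ys)) _)
               (cong₂ _+_ (cong sum (sym (map-∘ ys))) (sum-map-cartesianProduct xs ys h)))
  where
  h′ : A × B → ℕ
  h′ s = h (proj₁ s) (proj₂ s)

map-tabulate : ∀ {A B : Set} n (g : Fin n → A) (h : A → B) (H : ℕ → B) →
               (∀ i → h (g i) ≡ H (toℕ i)) → map h (List.tabulate g) ≡ applyUpTo H n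
map-tabulate zero    g h H h≗H = refl
map-tabulate (suc n) g h H h≗H =
  cong₂ _∷_ (h≗H Fin.zero) (map-tabulate n (g ∘ Fin.suc) h (H ∘ suc) (h≗H ∘ Fin.suc))

sum-map-cells : ∀ k n (h : Cell k n → ℕ) (H : ℕ → ℕ → ℕ) →
                (∀ r c → h (r , c) ≡ H (toℕ r) (toℕ c)) →
                sum (map h (cells k n)) ≡ ∑[ a < k ] ∑[ b < n ] H a b
sum-map-cells k n h H h≗H =
  trans (sum-map-cartesianProduct (allFin k) (allFin n) (λ r c → h (r , c)))
        (cong sum (map-tabulate k (λ r → r) _ _
          (λ r → cong sum (map-tabulate n (λ c → c) (λ c → h (r , c)) _ (h≗H r)))))

countLabel≡∑ : ∀ {k n} (T : Tab k n) m → countLabel T m ≡ ∑[ a < k ] ∑[ b < n ] 𝟙 (entry T a b ≡ᵇ m)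
countLabel≡∑ {k} {n} T m = sum-map-cells k n _ _ (λ r c → cong (λ u → 𝟙 (u ≡ᵇ m)) (label≡entry T r c))

inversionPosition : ℕ → ℕ → ℕ → ℕ → Bool
inversionPosition a b c d = ((b ≡ᵇ d) ∧ (a <ᵇ c)) ∨ ((suc b ≡ᵇ d) ∧ (c <ᵇ a))

inversionAt : ∀ {k n} → Tab k n → ℕ → ℕ → ℕ → ℕ → ℕ
inversionAt T a b c d = 𝟙 (inversionPosition a b c d ∧ (entry T c d <ᵇ entry T a b))

∑pairs : ℕ → ℕ → (ℕ → ℕ → ℕ → ℕ → ℕ) → ℕ
∑pairs k n F = ∑[ a < k ] ∑[ b < n ] ∑[ c < k ] ∑[ d < n ] F a b c d

Inv≡∑pairs : ∀ {k n} (T : Tab k n) → Inv T ≡ ∑pairs k n (inversionAt T)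
Inv≡∑pairs {k} {n} T =
  trans (sum-concatMap (λ s → map (λ t → 𝟙 (isInv T s t)) (cells k n)) (cells k n))
        (sum-map-cells k n _ _ λ r c → sum-map-cells k n _ _ λ r′ c′ →
          cong₂ (λ u v → 𝟙 (inversionPosition (toℕ r) (toℕ c) (toℕ r′) (toℕ c′) ∧ (u <ᵇ v)))
                (label≡entry T r′ c′) (label≡entry T r c))

-- Inversions between the rows x and y of consecutive components: the pairs of
-- cells (x b, y b) with y b < x b and (y b, x (suc b)) with x (suc b) < y b.
rowPairInvAt : ℕ → (ℕ → ℕ) → (ℕ → ℕ) → ℕ → ℕ
rowPairInvAt n x y b = 𝟙 (y b <ᵇ x b) + (if suc b <ᵇ n then 𝟙 (x (suc b) <ᵇ y b) else 0)

rowPairInv : ℕ → (ℕ → ℕ) → (ℕ → ℕ) → ℕ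
rowPairInv n x y = ∑< n (rowPairInvAt n x y)

rowPairInvAt-cong : ∀ n {x₁ y₁ x₂ y₂ : ℕ → ℕ} b → x₁ b ≡ x₂ b → y₁ b ≡ y₂ b →
                    (suc b < n → x₁ (suc b) ≡ x₂ (suc b)) → rowPairInvAt n x₁ y₁ b ≡ rowPairInvAt n x₂ y₂ b
rowPairInvAt-cong n b x≡ y≡ x≡′ with suc b <? n
... | yes sb<n rewrite <ᵇ-true sb<n = cong₂ _+_ (cong₂ (λ u v → 𝟙 (v <ᵇ u)) x≡ y≡) (cong₂ (λ u v → 𝟙 (u <ᵇ v)) (x≡′ sb<n) y≡)
... | no sb≮n rewrite <ᵇ-false (≮⇒≥ sb≮n) = cong (_+ 0) (cong₂ (λ u v → 𝟙 (v <ᵇ u)) x≡ y≡)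

rowPairInvAt-inner : ∀ n (x y : ℕ → ℕ) {b} → suc b < n → rowPairInvAt n x y b ≡ 𝟙 (y b <ᵇ x b) + 𝟙 (x (suc b) <ᵇ y b)
rowPairInvAt-inner n x y {b} sb<n = cong (λ t → 𝟙 (y b <ᵇ x b) + (if t then 𝟙 (x (suc b) <ᵇ y b) else 0)) (<ᵇ-true sb<n)

crossing-balance : ∀ {x₀ x₁ y₀ y₁} → x₀ ≤ x₁ → y₀ ≤ y₁ → x₁ < y₀ ⊎ y₁ < x₀ →
                   𝟙 (x₀ <ᵇ y₀) + 𝟙 (y₁ <ᵇ x₀) ≡ 𝟙 (y₀ <ᵇ x₀) + 𝟙 (x₁ <ᵇ y₀)
crossing-balance x₀≤x₁ y₀≤y₁ (inj₁ x₁<y₀) =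
  let x₀<y₀ = ≤-<-trans x₀≤x₁ x₁<y₀ in
  trans (cong₂ _+_ (𝟙<-one x₀<y₀) (𝟙<-zero (<⇒≤ (<-≤-trans x₀<y₀ y₀≤y₁))))
        (sym (cong₂ _+_ (𝟙<-zero (<⇒≤ x₀<y₀)) (𝟙<-one x₁<y₀)))
crossing-balance x₀≤x₁ y₀≤y₁ (inj₂ y₁<x₀) =
  let y₀<x₀ = ≤-<-trans y₀≤y₁ y₁<x₀ in
  trans (cong₂ _+_ (𝟙<-zero (<⇒≤ y₀<x₀)) (𝟙<-one y₁<x₀))
        (sym (cong₂ _+_ (𝟙<-one y₀<x₀) (𝟙<-zero (<⇒≤ (<-≤-trans y₀<x₀ x₀≤x₁)))))

splice : ℕ → (ℕ → ℕ) → (ℕ → ℕ) → ℕ → ℕ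
splice i x y b = if i ≤ᵇ b then y b else x b

splice-< : ∀ i (x y : ℕ → ℕ) {b} → b < i → splice i x y b ≡ x b
splice-< i x y {b} b<i = cong (λ t → if t then y b else x b) (≤ᵇ-false b<i)

splice-same : ∀ i (x : ℕ → ℕ) b → splice i x x b ≡ x b
splice-same i x b with i ≤ᵇ b
... | true  = refl
... | false = refl

splice-≥ : ∀ i (x y : ℕ → ℕ) {b} → i ≤ b → splice i x y b ≡ y b
splice-≥ i x y {b} i≤b = cong (λ t → if t then y b else x b) (≤ᵇ-true i≤b)

-- Two weakly increasing rows x, y on columns [0, n) that agree after column cs,
-- such that exchanging their tails from column i keeps both rows increasing
-- (joins), while no later start column up to cs does (crosses).
record TailSwappable (n cs i : ℕ) (x y : ℕ → ℕ) : Set where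
  field
    x-mono  : ∀ b → suc b < n → x b ≤ x (suc b)
    y-mono  : ∀ b → suc b < n → y b ≤ y (suc b)
    i≤cs    : i ≤ cs
    cs<n    : cs < n
    joins   : ∀ p → suc p ≡ i → x p ≤ y i × y p ≤ x i
    crosses : ∀ p → i ≤ p → p < cs → x (suc p) < y p ⊎ y (suc p) < x p
    agree   : ∀ p → cs < p → p < n → x p ≡ y p

module _ {n cs i : ℕ} {x y : ℕ → ℕ} (S : TailSwappable n cs i x y) where
  open TailSwappable S

  private
    x′ y′ : ℕ → ℕ
    x′ = splice i x y
    y′ = splice i y x

    before : ∀ b → suc b < i → rowPairInvAt n x′ y′ b ≡ rowPairInvAt n x y b
    before b sb<i = rowPairInvAt-cong n {x′} {y′} {x} {y} b (splice-< i x y b<i) (splice-< i y x b<i) (λ _ → splice-< i x y sb<i)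
      where
      b<i : b < i
      b<i = <-trans (n<1+n b) sb<i

    atJoin : ∀ b → suc b ≡ i → rowPairInvAt n x′ y′ b ≡ rowPairInvAt n x y b
    atJoin b refl = begin
      rowPairInvAt n x′ y′ b                          ≡⟨ rowPairInvAt-inner n x′ y′ sb<n ⟩
      𝟙 (y′ b <ᵇ x′ b) + 𝟙 (x′ (suc b) <ᵇ y′ b)       ≡⟨ cong₂ _+_ (cong₂ (λ u v → 𝟙 (v <ᵇ u)) (splice-< i x y b<i) (splice-< i y x b<i))
                                                                 (cong₂ (λ u v → 𝟙 (u <ᵇ v)) (splice-≥ i x y ≤-refl) (splice-< i y x b<i)) ⟩
      𝟙 (y b <ᵇ x b) + 𝟙 (y (suc b) <ᵇ y b)          ≡⟨ cong (𝟙 (y b <ᵇ x b) +_) (trans (𝟙<-zero (y-mono b sb<n))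
                                                                                          (sym (𝟙<-zero (proj₂ (joins b refl))))) ⟩
      𝟙 (y b <ᵇ x b) + 𝟙 (x (suc b) <ᵇ y b)          ≡⟨ rowPairInvAt-inner n x y sb<n ⟨
      rowPairInvAt n x y b                            ∎
      where
      open ≡-Reasoning
      b<i : b < suc b
      b<i = n<1+n b
      sb<n : suc b < n
      sb<n = ≤-<-trans i≤cs cs<n

    inside : ∀ b → i ≤ b → b < cs → rowPairInvAt n x′ y′ b ≡ rowPairInvAt n x y b
    inside b i≤b b<cs = begin
      rowPairInvAt n x′ y′ b                          ≡⟨ rowPairInvAt-inner n x′ y′ sb<n ⟩
      𝟙 (y′ b <ᵇ x′ b) + 𝟙 (x′ (suc b) <ᵇ y′ b)       ≡⟨ cong₂ _+_ (cong₂ (λ u v → 𝟙 (v <ᵇ u)) (splice-≥ i x y i≤b) (splice-≥ i y x i≤b))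
                                                                 (cong₂ (λ u v → 𝟙 (u <ᵇ v)) (splice-≥ i x y i≤sb) (splice-≥ i y x i≤b)) ⟩
      𝟙 (x b <ᵇ y b) + 𝟙 (y (suc b) <ᵇ x b)          ≡⟨ crossing-balance (x-mono b sb<n) (y-mono b sb<n) (crosses b i≤b b<cs) ⟩
      𝟙 (y b <ᵇ x b) + 𝟙 (x (suc b) <ᵇ y b)          ≡⟨ rowPairInvAt-inner n x y sb<n ⟨
      rowPairInvAt n x y b                            ∎
      where
      open ≡-Reasoning
      sb<n : suc b < n
      sb<n = ≤-<-trans b<cs cs<n
      i≤sb : i ≤ suc b
      i≤sb = m≤n⇒m≤1+n i≤b

    after : ∀ b → cs < b → b < n → rowPairInvAt n x′ y′ b ≡ rowPairInvAt n x y b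
    after b cs<b b<n = rowPairInvAt-cong n {x′} {y′} {x} {y} b
      (trans (splice-≥ i x y i≤b) (sym (agree b cs<b b<n)))
      (trans (splice-≥ i y x i≤b) (agree b cs<b b<n))
      (λ sb<n → trans (splice-≥ i x y (m≤n⇒m≤1+n i≤b)) (sym (agree (suc b) (m<n⇒m<1+n cs<b) sb<n)))
      where
      i≤b : i ≤ b
      i≤b = ≤-trans i≤cs (<⇒≤ cs<b)

    away : ∀ b → b < n → b ≢ cs → rowPairInvAt n x′ y′ b ≡ rowPairInvAt n x y b
    away b b<n b≢cs with <-cmp b cs
    ... | tri≈ _ b≡cs _ = ⊥-elim (b≢cs b≡cs)
    ... | tri> _ _ cs<b = after b cs<b b<n
    ... | tri< b<cs _ _ with i ≤? b
    ...   | yes i≤b = inside b i≤b b<cs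
    ...   | no  i≰b with suc b <? i
    ...     | yes sb<i = before b sb<i
    ...     | no  sb≮i = atJoin b (≤-antisym (≰⇒> i≰b) (≮⇒≥ sb≮i))

    noCrossAt-cs : ∀ (u v : ℕ → ℕ) → (suc cs < n → v cs ≤ u (suc cs)) →
                   rowPairInvAt n u v cs ≡ 𝟙 (v cs <ᵇ u cs)
    noCrossAt-cs u v v≤u with suc cs <? n
    ... | yes scs<n = trans (rowPairInvAt-inner n u v scs<n) (trans (cong (𝟙 (v cs <ᵇ u cs) +_) (𝟙<-zero (v≤u scs<n))) (+-identityʳ _))
    ... | no  scs≮n rewrite <ᵇ-false (≮⇒≥ scs≮n) = +-identityʳ _

    atCs : rowPairInvAt n x′ y′ cs + 𝟙 (y cs <ᵇ x cs) ≡ rowPairInvAt n x y cs + 𝟙 (x cs <ᵇ y cs)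
    atCs = begin
      rowPairInvAt n x′ y′ cs + 𝟙 (y cs <ᵇ x cs)  ≡⟨ cong (_+ 𝟙 (y cs <ᵇ x cs)) (noCrossAt-cs x′ y′ y′≤x′) ⟩
      𝟙 (y′ cs <ᵇ x′ cs) + 𝟙 (y cs <ᵇ x cs)       ≡⟨ cong (_+ 𝟙 (y cs <ᵇ x cs)) (cong₂ (λ u v → 𝟙 (v <ᵇ u)) (splice-≥ i x y i≤cs) (splice-≥ i y x i≤cs)) ⟩
      𝟙 (x cs <ᵇ y cs) + 𝟙 (y cs <ᵇ x cs)         ≡⟨ +-comm (𝟙 (x cs <ᵇ y cs)) _ ⟩
      𝟙 (y cs <ᵇ x cs) + 𝟙 (x cs <ᵇ y cs)         ≡⟨ cong (_+ 𝟙 (x cs <ᵇ y cs)) (noCrossAt-cs x y y≤x) ⟨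
      rowPairInvAt n x y cs + 𝟙 (x cs <ᵇ y cs)    ∎
      where
      open ≡-Reasoning
      y′≤x′ : suc cs < n → y′ cs ≤ x′ (suc cs)
      y′≤x′ scs<n = subst₂ _≤_ (sym (splice-≥ i y x i≤cs))
                               (trans (agree (suc cs) (n<1+n cs) scs<n) (sym (splice-≥ i x y (m≤n⇒m≤1+n i≤cs))))
                               (x-mono cs scs<n)
      y≤x : suc cs < n → y cs ≤ x (suc cs)
      y≤x scs<n = subst (y cs ≤_) (sym (agree (suc cs) (n<1+n cs) scs<n)) (y-mono cs scs<n)

  rowPairInv-splice : rowPairInv n (splice i x y) (splice i y x) + 𝟙 (y cs <ᵇ x cs) ≡ rowPairInv n x y + 𝟙 (x cs <ᵇ y cs)
  rowPairInv-splice = ∑<-differ-at n _ _ cs<n away atCs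

inPair : ℕ → ℕ → Bool
inPair j a = (j ≡ᵇ a) ∨ (suc j ≡ᵇ a)

inPair-first : ∀ j → inPair j j ≡ true
inPair-first j rewrite ≡ᵇ-refl j = refl

inPair-second : ∀ j → inPair j (suc j) ≡ true
inPair-second j rewrite ≡ᵇ-refl j = ∨-zeroʳ (j ≡ᵇ suc j)

inPair-false : ∀ j {a} → inPair j a ≡ false → a ≢ j × a ≢ suc j
inPair-false j e = (λ { refl → true≢false (trans (sym (inPair-first j)) e) })
                 , (λ { refl → true≢false (trans (sym (inPair-second j)) e) })
  where
  true≢false : true ≢ false
  true≢false ()

inPair-transpose : ∀ j a → inPair j (transpose j a) ≡ inPair j a
inPair-transpose j a with transpose j a | transpose-view j a
... | _ | first     = trans (inPair-second j) (sym (inPair-first j))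
... | _ | second    = trans (inPair-first j) (sym (inPair-second j))
... | _ | fixed _ _ = refl

inPair-split : ∀ j c (g : ℕ → ℕ) →
               (if inPair j c then g c else 0) ≡ (if j ≡ᵇ c then g c else 0) + (if suc j ≡ᵇ c then g c else 0)
inPair-split j c g with j ≟ c
... | yes refl rewrite ≡ᵇ-refl j | ≡ᵇ-false (1+n≢n {j}) = sym (+-identityʳ (g j))
... | no  j≢c rewrite ≡ᵇ-false j≢c with suc j ≡ᵇ c
...   | true  = refl
...   | false = refl

∑<-inPair : ∀ k j (g : ℕ → ℕ) → suc j < k → ∑[ c < k ] (if inPair j c then g c else 0) ≡ g j + g (suc j)
∑<-inPair k j g sj<k = begin
  ∑[ c < k ] (if inPair j c then g c else 0)
    ≡⟨ ∑<-cong k (λ c _ → inPair-split j c g) ⟩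
  ∑[ c < k ] ((if j ≡ᵇ c then g c else 0) + (if suc j ≡ᵇ c then g c else 0))
    ≡⟨ ∑<-distrib-+ k _ _ ⟩
  ∑[ c < k ] (if j ≡ᵇ c then g c else 0) + ∑[ c < k ] (if suc j ≡ᵇ c then g c else 0)
    ≡⟨ cong₂ _+_ (∑<-delta k j g) (∑<-delta k (suc j) g) ⟩
  (if j <ᵇ k then g j else 0) + (if suc j <ᵇ k then g (suc j) else 0)
    ≡⟨ cong₂ _+_ (cong (λ t → if t then g j else 0) (<ᵇ-true (<-trans (n<1+n j) sj<k)))
                 (cong (λ t → if t then g (suc j) else 0) (<ᵇ-true sj<k)) ⟩
  g j + g (suc j) ∎
  where open ≡-Reasoning

tailTranspose : ℕ → ℕ → ℕ → ℕ → ℕ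
tailTranspose j i a b = if i ≤ᵇ b then transpose j a else a

tailTranspose-involutive : ∀ j i a b → tailTranspose j i (tailTranspose j i a b) b ≡ a
tailTranspose-involutive j i a b with i ≤ᵇ b
... | true  = transpose-involutive j a
... | false = refl

tailTranspose-< : ∀ {k} j i {a} b → suc j < k → a < k → tailTranspose j i a b < k
tailTranspose-< j i b sj<k a<k with i ≤ᵇ b
... | true  = transpose-< j sj<k a<k
... | false = a<k

inPair-tailTranspose : ∀ j i a b → inPair j (tailTranspose j i a b) ≡ inPair j a
inPair-tailTranspose j i a b with i ≤ᵇ b
... | true  = inPair-transpose j a
... | false = refl

tailTranspose-fixed : ∀ j i {a} b → inPair j a ≡ false → tailTranspose j i a b ≡ a
tailTranspose-fixed j i b e with i ≤ᵇ b
... | true  = transpose-fixed j (proj₁ (inPair-false j e)) (proj₂ (inPair-false j e))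
... | false = refl

module _ (j i : ℕ) {c : ℕ} (c∉ : inPair j c ≡ false) where

  tailTranspose-<ᵇˡ : ∀ a b → (tailTranspose j i a b <ᵇ c) ≡ (a <ᵇ c)
  tailTranspose-<ᵇˡ a b with i ≤ᵇ b
  ... | true  = transpose-<ᵇˡ j c (proj₁ (inPair-false j c∉)) (proj₂ (inPair-false j c∉)) a
  ... | false = refl

  tailTranspose-<ᵇʳ : ∀ a b → (c <ᵇ tailTranspose j i a b) ≡ (c <ᵇ a)
  tailTranspose-<ᵇʳ a b with i ≤ᵇ b
  ... | true  = transpose-<ᵇʳ j c (proj₁ (inPair-false j c∉)) (proj₂ (inPair-false j c∉)) a
  ... | false = refl

inversionPosition-tailTranspose : ∀ j i a b c d → (inPair j a ∧ inPair j c) ≡ false →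
  inversionPosition (tailTranspose j i a b) b (tailTranspose j i c d) d ≡ inversionPosition a b c d
inversionPosition-tailTranspose j i a b c d notBoth with inPair j a in a∈
... | false rewrite tailTranspose-fixed j i b a∈ =
  cong₂ (λ u v → ((b ≡ᵇ d) ∧ u) ∨ ((suc b ≡ᵇ d) ∧ v)) (tailTranspose-<ᵇʳ j i a∈ c d) (tailTranspose-<ᵇˡ j i a∈ c d)
... | true  rewrite tailTranspose-fixed j i d notBoth =
  cong₂ (λ u v → ((b ≡ᵇ d) ∧ u) ∨ ((suc b ≡ᵇ d) ∧ v)) (tailTranspose-<ᵇˡ j i notBoth a b) (tailTranspose-<ᵇʳ j i notBoth a b)

module _ (k n j i : ℕ) (sj<k : suc j < k) where

  applyUpTo-tailTranspose : ∀ {A : Set} b (f : ℕ → A) → applyUpTo (λ a → f (tailTranspose j i a b)) k ↭ applyUpTo f k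
  applyUpTo-tailTranspose b f with i ≤ᵇ b
  ... | true  = applyUpTo-transpose k j f sj<k
  ... | false = ↭-refl

  ∑cells-tailTranspose : ∀ (h : ℕ → ℕ → ℕ) →
    ∑[ a < k ] ∑[ b < n ] h (tailTranspose j i a b) b ≡ ∑[ a < k ] ∑[ b < n ] h a b
  ∑cells-tailTranspose h = trans (∑<-comm k n _) (trans (∑<-cong n (λ b _ → column b)) (sym (∑<-comm k n _)))
    where
    column : ∀ b → ∑[ a < k ] h (tailTranspose j i a b) b ≡ ∑[ a < k ] h a b
    column b = sum-↭ (applyUpTo-tailTranspose b (λ a → h a b))

  ∑pairs-tailTranspose : ∀ (F : ℕ → ℕ → ℕ → ℕ → ℕ) →
    ∑pairs k n (λ a b c d → F (tailTranspose j i a b) b (tailTranspose j i c d) d) ≡ ∑pairs k n F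
  ∑pairs-tailTranspose F =
    trans (∑<-cong k (λ a _ → ∑<-cong n (λ b _ → ∑cells-tailTranspose (F (tailTranspose j i a b) b))))
          (∑cells-tailTranspose (λ a b → ∑[ c < k ] ∑[ d < n ] F a b c d))

outsideInv insideInv : ∀ {k n} → ℕ → Tab k n → ℕ → ℕ → ℕ → ℕ → ℕ
outsideInv j T a b c d = if inPair j a ∧ inPair j c then 0 else inversionAt T a b c d
insideInv  j T a b c d = if inPair j a ∧ inPair j c then inversionAt T a b c d else 0

inversionAt-split : ∀ {k n} j (T : Tab k n) a b c d → inversionAt T a b c d ≡ outsideInv j T a b c d + insideInv j T a b c d
inversionAt-split j T a b c d with inPair j a ∧ inPair j c
... | true  = refl
... | false = sym (+-identityʳ _)

∑pairs-outsideInv-tailTranspose : ∀ {k n} j i → suc j < k → (T U : Tab k n) →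
  (∀ a b → entry U a b ≡ entry T (tailTranspose j i a b) b) →
  ∑pairs k n (outsideInv j U) ≡ ∑pairs k n (outsideInv j T)
∑pairs-outsideInv-tailTranspose {k} {n} j i sj<k T U U≡T∘π =
  trans (sym (∑pairs-tailTranspose k n j i sj<k (outsideInv j U)))
        (∑<-cong k λ a _ → ∑<-cong n λ b _ → ∑<-cong k λ c _ → ∑<-cong n λ d _ → pointwise a b c d)
  where
  π : ℕ → ℕ → ℕ
  π = tailTranspose j i
  pointwise : ∀ a b c d → outsideInv j U (π a b) b (π c d) d ≡ outsideInv j T a b c d
  pointwise a b c d rewrite inPair-tailTranspose j i a b | inPair-tailTranspose j i c d
    with inPair j a ∧ inPair j c in notBoth
  ... | true  = refl
  ... | false rewrite inversionPosition-tailTranspose j i a b c d notBoth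
                    | U≡T∘π (π a b) b | U≡T∘π (π c d) d
                    | tailTranspose-involutive j i a b | tailTranspose-involutive j i c d = refl

module _ {k n : ℕ} (j : ℕ) (T : Tab k n) where

  private
    x y : ℕ → ℕ
    x = entry T j
    y = entry T (suc j)

    F : ℕ → ℕ → ℕ → ℕ → ℕ
    F = inversionAt T

    sameRow : ∀ a b d → F a b a d ≡ 0
    sameRow a b d rewrite <ᵇ-false (≤-refl {a}) | ∧-zeroʳ (b ≡ᵇ d) | ∧-zeroʳ (suc b ≡ᵇ d) = refl

    downward : ∀ b d → F j b (suc j) d ≡ (if b ≡ᵇ d then 𝟙 (y d <ᵇ x b) else 0)
    downward b d rewrite <ᵇ-true (n<1+n j) | <ᵇ-false (n≤1+n j)
                       | ∧-identityʳ (b ≡ᵇ d) | ∧-zeroʳ (suc b ≡ᵇ d) | ∨-identityʳ (b ≡ᵇ d) with b ≡ᵇ d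
    ... | true  = refl
    ... | false = refl

    upward : ∀ b d → F (suc j) b j d ≡ (if suc b ≡ᵇ d then 𝟙 (x d <ᵇ y b) else 0)
    upward b d rewrite <ᵇ-true (n<1+n j) | <ᵇ-false (n≤1+n j)
                     | ∧-identityʳ (suc b ≡ᵇ d) | ∧-zeroʳ (b ≡ᵇ d) with suc b ≡ᵇ d
    ... | true  = refl
    ... | false = refl

    R : ℕ → ℕ → ℕ
    R a b = ∑< n (F a b j) + ∑< n (F a b (suc j))

    rowsOf : ∀ b → b < n → R j b + R (suc j) b ≡ rowPairInvAt n x y b
    rowsOf b b<n = begin
      R j b + R (suc j) b
        ≡⟨ cong₂ _+_ (cong₂ _+_ (∑<-cong n (λ d _ → sameRow j b d)) (∑<-cong n (λ d _ → downward b d)))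
                     (cong₂ _+_ (∑<-cong n (λ d _ → upward b d)) (∑<-cong n (λ d _ → sameRow (suc j) b d))) ⟩
      (∑[ d < n ] 0 + ∑[ d < n ] (if b ≡ᵇ d then 𝟙 (y d <ᵇ x b) else 0))
        + (∑[ d < n ] (if suc b ≡ᵇ d then 𝟙 (x d <ᵇ y b) else 0) + ∑[ d < n ] 0)
        ≡⟨ cong₂ _+_ (cong₂ _+_ (∑<-zero n) (∑<-delta n b (λ d → 𝟙 (y d <ᵇ x b))))
                     (cong₂ _+_ (∑<-delta n (suc b) (λ d → 𝟙 (x d <ᵇ y b))) (∑<-zero n)) ⟩
      (if b <ᵇ n then 𝟙 (y b <ᵇ x b) else 0) + ((if suc b <ᵇ n then 𝟙 (x (suc b) <ᵇ y b) else 0) + 0)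
        ≡⟨ cong₂ _+_ (cong (λ t → if t then 𝟙 (y b <ᵇ x b) else 0) (<ᵇ-true b<n)) (+-identityʳ _) ⟩
      rowPairInvAt n x y b ∎
      where open ≡-Reasoning

  ∑pairs-insideInv : suc j < k → ∑pairs k n (insideInv j T) ≡ rowPairInv n x y
  ∑pairs-insideInv sj<k = begin
    ∑pairs k n (insideInv j T)                    ≡⟨ ∑<-cong k (λ a _ → restrict a) ⟩
    ∑[ a < k ] (if inPair j a then S a else 0)    ≡⟨ ∑<-inPair k j S sj<k ⟩
    S j + S (suc j)                               ≡⟨ cong₂ _+_ (S≡∑R j) (S≡∑R (suc j)) ⟩
    ∑< n (R j) + ∑< n (R (suc j))                 ≡⟨ ∑<-distrib-+ n (R j) (R (suc j)) ⟨
    ∑[ b < n ] (R j b + R (suc j) b)              ≡⟨ ∑<-cong n rowsOf ⟩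
    rowPairInv n x y                              ∎
    where
    open ≡-Reasoning
    S : ℕ → ℕ
    S a = ∑[ b < n ] ∑[ c < k ] ∑[ d < n ] (if inPair j c then F a b c d else 0)
    restrict : ∀ a → ∑[ b < n ] ∑[ c < k ] ∑[ d < n ] insideInv j T a b c d ≡ (if inPair j a then S a else 0)
    restrict a with inPair j a
    ... | true  = refl
    ... | false = trans (∑<-cong n (λ b _ → trans (∑<-cong k (λ c _ → ∑<-zero n)) (∑<-zero k))) (∑<-zero n)
    S≡∑R : ∀ a → S a ≡ ∑< n (R a)
    S≡∑R a = ∑<-cong n λ b _ →
      trans (∑<-cong k (λ c _ → ∑<-if n (inPair j c) (F a b c))) (∑<-inPair k j (λ c → ∑< n (F a b c)) sj<k)

  Inv-splitAtRows : suc j < k → Inv T ≡ ∑pairs k n (outsideInv j T) + rowPairInv n x y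
  Inv-splitAtRows sj<k = begin
    Inv T                                                      ≡⟨ Inv≡∑pairs T ⟩
    ∑pairs k n F                                               ≡⟨ ∑<-cong k (λ a _ → ∑<-cong n λ b _ → ∑<-cong k λ c _ → ∑<-cong n λ d _ → inversionAt-split j T a b c d) ⟩
    ∑pairs k n (λ a b c d → outsideInv j T a b c d + insideInv j T a b c d) ≡⟨ ∑pairs-distrib-+ ⟩
    ∑pairs k n (outsideInv j T) + ∑pairs k n (insideInv j T)   ≡⟨ cong (∑pairs k n (outsideInv j T) +_) (∑pairs-insideInv sj<k) ⟩
    ∑pairs k n (outsideInv j T) + rowPairInv n x y             ∎
    where
    open ≡-Reasoning
    ∑pairs-distrib-+ : ∑pairs k n (λ a b c d → outsideInv j T a b c d + insideInv j T a b c d)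
                     ≡ ∑pairs k n (outsideInv j T) + ∑pairs k n (insideInv j T)
    ∑pairs-distrib-+ =
      trans (∑<-cong k λ a _ → trans (∑<-cong n λ b _ → trans (∑<-cong k λ c _ → ∑<-distrib-+ n _ _) (∑<-distrib-+ k _ _))
                                    (∑<-distrib-+ n _ _))
            (∑<-distrib-+ k _ _)

rowPairInv-cong : ∀ n {x₁ y₁ x₂ y₂ : ℕ → ℕ} → (∀ b → x₁ b ≡ x₂ b) → (∀ b → y₁ b ≡ y₂ b) →
                  rowPairInv n x₁ y₁ ≡ rowPairInv n x₂ y₂
rowPairInv-cong n {x₁} {y₁} {x₂} {y₂} x≗ y≗ =
  ∑<-cong n (λ b _ → rowPairInvAt-cong n {x₁} {y₁} {x₂} {y₂} b (x≗ b) (y≗ b) (λ _ → x≗ (suc b)))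

Inv-tailTranspose : ∀ {k n} j i cs → suc j < k → (T U : Tab k n) →
  (∀ a b → entry U a b ≡ entry T (tailTranspose j i a b) b) →
  TailSwappable n cs i (entry T j) (entry T (suc j)) →
  Inv U + 𝟙 (entry T (suc j) cs <ᵇ entry T j cs) ≡ Inv T + 𝟙 (entry T j cs <ᵇ entry T (suc j) cs)
Inv-tailTranspose {k} {n} j i cs sj<k T U U≡T∘π S = begin
  Inv U + 𝟙 (y cs <ᵇ x cs)
    ≡⟨ cong (_+ 𝟙 (y cs <ᵇ x cs)) (Inv-splitAtRows j U sj<k) ⟩
  ∑pairs k n (outsideInv j U) + rowPairInv n (entry U j) (entry U (suc j)) + 𝟙 (y cs <ᵇ x cs)
    ≡⟨ cong (λ t → t + 𝟙 (y cs <ᵇ x cs))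
            (cong₂ _+_ (∑pairs-outsideInv-tailTranspose j i sj<k T U U≡T∘π)
                       (rowPairInv-cong n (λ b → trans (U≡T∘π j b) (rowOf j b (transpose-first j)))
                                          (λ b → trans (U≡T∘π (suc j) b) (rowOf (suc j) b (transpose-second j))))) ⟩
  ∑pairs k n (outsideInv j T) + rowPairInv n (splice i x y) (splice i y x) + 𝟙 (y cs <ᵇ x cs)
    ≡⟨ +-assoc (∑pairs k n (outsideInv j T)) _ _ ⟩
  ∑pairs k n (outsideInv j T) + (rowPairInv n (splice i x y) (splice i y x) + 𝟙 (y cs <ᵇ x cs))
    ≡⟨ cong (∑pairs k n (outsideInv j T) +_) (rowPairInv-splice S) ⟩
  ∑pairs k n (outsideInv j T) + (rowPairInv n x y + 𝟙 (x cs <ᵇ y cs))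
    ≡⟨ +-assoc (∑pairs k n (outsideInv j T)) _ _ ⟨
  ∑pairs k n (outsideInv j T) + rowPairInv n x y + 𝟙 (x cs <ᵇ y cs)
    ≡⟨ cong (_+ 𝟙 (x cs <ᵇ y cs)) (Inv-splitAtRows j T sj<k) ⟨
  Inv T + 𝟙 (x cs <ᵇ y cs) ∎
  where
  open ≡-Reasoning
  x y : ℕ → ℕ
  x = entry T j
  y = entry T (suc j)
  rowOf : ∀ a b {a′} → transpose j a ≡ a′ → entry T (tailTranspose j i a b) b ≡ splice i (entry T a) (entry T a′) b
  rowOf a b refl with i ≤ᵇ b
  ... | true  = refl
  ... | false = refl

lastTrue : (ℕ → Bool) → ℕ → ℕ
lastTrue f zero    = zero
lastTrue f (suc p) = if f (suc p) then suc p else lastTrue f p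

lastTrue-≤ : ∀ (f : ℕ → Bool) p → lastTrue f p ≤ p
lastTrue-≤ f zero    = z≤n
lastTrue-≤ f (suc p) with f (suc p)
... | true  = ≤-refl
... | false = m≤n⇒m≤1+n (lastTrue-≤ f p)

lastTrue-true : ∀ (f : ℕ → Bool) → f 0 ≡ true → ∀ p → f (lastTrue f p) ≡ true
lastTrue-true f f0 zero    = f0
lastTrue-true f f0 (suc p) with f (suc p) in fsp
... | true  = fsp
... | false = lastTrue-true f f0 p

lastTrue-max : ∀ (f : ℕ → Bool) p {q} → lastTrue f p < q → q ≤ p → f q ≡ false
lastTrue-max f zero    last<q q≤p = ⊥-elim (<⇒≱ last<q q≤p)
lastTrue-max f (suc p) {q} last<q q≤p with f (suc p) in fsp
... | true  = ⊥-elim (<⇒≱ last<q q≤p)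
... | false with q ≟ suc p
...   | yes refl = fsp
...   | no  q≢sp = lastTrue-max f p last<q (≤-pred (≤∧≢⇒< q≤p q≢sp))

lastTrue-unique : ∀ (f : ℕ → Bool) p {i} → i ≤ p → f i ≡ true → (∀ q → i < q → q ≤ p → f q ≡ false) → lastTrue f p ≡ i
lastTrue-unique f zero    z≤n _  _     = refl
lastTrue-unique f (suc p) {i} i≤sp fi later with i ≟ suc p
... | yes refl rewrite fi = refl
... | no  i≢sp rewrite later (suc p) (≤∧≢⇒< i≤sp i≢sp) ≤-refl =
  lastTrue-unique f p (≤-pred (≤∧≢⇒< i≤sp i≢sp)) fi (λ q i<q q≤p → later q i<q (m≤n⇒m≤1+n q≤p))

-- Whether exchanging the tails of rows x and y from column p on keeps both
-- rows weakly increasing across column p.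
joinable : (ℕ → ℕ) → (ℕ → ℕ) → ℕ → Bool
joinable x y zero    = true
joinable x y (suc p) = (x p ≤ᵇ y (suc p)) ∧ (y p ≤ᵇ x (suc p))

Monotone< : ℕ → (ℕ → ℕ) → Set
Monotone< n x = ∀ {b b′} → b ≤ b′ → b′ < n → x b ≤ x b′

Monotone<-resp : ∀ {n} {x y : ℕ → ℕ} → (∀ b → x b ≡ y b) → Monotone< n y → Monotone< n x
Monotone<-resp {x = x} {y} x≗y y↑ {b} {b′} b≤b′ b′<n = subst₂ _≤_ (sym (x≗y b)) (sym (x≗y b′)) (y↑ b≤b′ b′<n)

splice-monotone : ∀ n i {x y : ℕ → ℕ} → Monotone< n x → Monotone< n y →
                  (∀ p → suc p ≡ i → i < n → x p ≤ y i) → Monotone< n (splice i x y)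
splice-monotone n i {x} {y} x↑ y↑ join {b} {b′} b≤b′ b′<n with i ≤? b | i ≤? b′
... | yes i≤b | yes i≤b′ rewrite ≤ᵇ-true i≤b | ≤ᵇ-true i≤b′ = y↑ b≤b′ b′<n
... | yes i≤b | no  i≰b′ = ⊥-elim (i≰b′ (≤-trans i≤b b≤b′))
... | no  i≰b | no  i≰b′ rewrite ≤ᵇ-false (≰⇒> i≰b) | ≤ᵇ-false (≰⇒> i≰b′) = x↑ b≤b′ b′<n
... | no  i≰b | yes i≤b′ rewrite ≤ᵇ-false (≰⇒> i≰b) | ≤ᵇ-true i≤b′ with i
...   | zero   = ⊥-elim (i≰b z≤n)
...   | suc i′ = ≤-trans (x↑ (≤-pred (≰⇒> i≰b)) (<-≤-trans (n<1+n i′) (≤-trans i≤b′ (<⇒≤ b′<n))))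
                         (≤-trans (join i′ refl (≤-<-trans i≤b′ b′<n)) (y↑ i≤b′ b′<n))

joinable-cong : ∀ {x₁ y₁ x₂ y₂ : ℕ → ℕ} → (∀ b → x₁ b ≡ x₂ b) → (∀ b → y₁ b ≡ y₂ b) →
                ∀ q → joinable x₁ y₁ q ≡ joinable x₂ y₂ q
joinable-cong x≗ y≗ zero    = refl
joinable-cong x≗ y≗ (suc p) = cong₂ _∧_ (cong₂ _≤ᵇ_ (x≗ p) (y≗ (suc p))) (cong₂ _≤ᵇ_ (y≗ p) (x≗ (suc p)))

joinable-splice : ∀ {n} i (x y : ℕ → ℕ) → i < n → Monotone< n x → Monotone< n y →
                  joinable (splice i x y) (splice i y x) i ≡ true
joinable-splice zero    x y _    _  _  = refl
joinable-splice (suc p) x y sp<n x↑ y↑ = cong₂ _∧_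
  (trans (cong₂ _≤ᵇ_ (splice-< (suc p) x y (n<1+n p)) (splice-≥ (suc p) y x ≤-refl)) (≤ᵇ-true (x↑ (n≤1+n p) sp<n)))
  (trans (cong₂ _≤ᵇ_ (splice-< (suc p) y x (n<1+n p)) (splice-≥ (suc p) x y ≤-refl)) (≤ᵇ-true (y↑ (n≤1+n p) sp<n)))

joinable-splice-after : ∀ i (x y : ℕ → ℕ) {q} → i < q → joinable (splice i x y) (splice i y x) q ≡ joinable x y q
joinable-splice-after i x y {suc p} (s≤s i≤p) =
  trans (cong₂ _∧_ (cong₂ _≤ᵇ_ (splice-≥ i x y i≤p) (splice-≥ i y x (m≤n⇒m≤1+n i≤p)))
                   (cong₂ _≤ᵇ_ (splice-≥ i y x i≤p) (splice-≥ i x y (m≤n⇒m≤1+n i≤p))))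
        (∧-comm (y p ≤ᵇ x (suc p)) (x p ≤ᵇ y (suc p)))

record Admissible {k n : ℕ} (cs : ℕ) (T : Tab k n) : Set where
  field
    rows-monotone : ∀ {a} → a < k → Monotone< n (entry T a)
    flat-after    : ∀ {a a′ p} → a < k → a′ < k → cs < p → p < n → entry T a p ≡ entry T a′ p

column≡applyUpTo : ∀ {k n} (T : Tab k n) (c : Fin n) → map (λ r → label T r c) (allFin k) ≡ applyUpTo (λ a → entry T a (toℕ c)) k
column≡applyUpTo {k} T c = map-tabulate k (λ r → r) (λ r → label T r c) _ (λ r → label≡entry T r c)

module TailSwap {k n : ℕ} (cs : ℕ) (cs<n : cs < n) where

  start : Tab k n → ℕ → ℕ
  start T j = lastTrue (joinable (entry T j) (entry T (suc j))) cs

  tailSwap : ℕ → Tab k n → Tab k n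
  tailSwap j T = tabulateEntries (λ a b → entry T (tailTranspose j (start T j) a b) b)

  module _ (j : ℕ) (sj<k : suc j < k) where

    entry-tailSwap : ∀ T a b → entry (tailSwap j T) a b ≡ entry T (tailTranspose j (start T j) a b) b
    entry-tailSwap T a b with a <? k | b <? n
    ... | yes a<k | yes b<n = entry-tabulateEntries _ a<k b<n
    ... | _       | no  b≮n = trans (entry-≥col (tailSwap j T) a (≮⇒≥ b≮n)) (sym (entry-≥col T _ (≮⇒≥ b≮n)))
    ... | no  a≮k | yes _   = trans (entry-≥row (tailSwap j T) b (≮⇒≥ a≮k))
                                    (sym (trans (cong (λ a′ → entry T a′ b) outside) (entry-≥row T b (≮⇒≥ a≮k))))
      where
      outside : tailTranspose j (start T j) a b ≡ a
      outside with start T j ≤ᵇ b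
      ... | true  = transpose-≥ j sj<k (≮⇒≥ a≮k)
      ... | false = refl

    tailSwap-row : ∀ T a {a′} → transpose j a ≡ a′ → ∀ b →
                   entry (tailSwap j T) a b ≡ splice (start T j) (entry T a) (entry T a′) b
    tailSwap-row T a refl b rewrite entry-tailSwap T a b with start T j ≤ᵇ b
    ... | true  = refl
    ... | false = refl

    tailSwap-first : ∀ T b → entry (tailSwap j T) j b ≡ splice (start T j) (entry T j) (entry T (suc j)) b
    tailSwap-first T = tailSwap-row T j (transpose-first j)

    tailSwap-second : ∀ T b → entry (tailSwap j T) (suc j) b ≡ splice (start T j) (entry T (suc j)) (entry T j) b
    tailSwap-second T = tailSwap-row T (suc j) (transpose-second j)

    tailSwap-other : ∀ T {a} → a ≢ j → a ≢ suc j → ∀ b → entry (tailSwap j T) a b ≡ entry T a b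
    tailSwap-other T a≢j a≢sj b = trans (tailSwap-row T _ (transpose-fixed j a≢j a≢sj) b) (splice-same (start T j) (entry T _) b)

  module _ (j : ℕ) (sj<k : suc j < k) (T : Tab k n) (A : Admissible cs T) where

    open Admissible A

    private
      I : ℕ
      I = start T j
      x y : ℕ → ℕ
      x = entry T j
      y = entry T (suc j)
      j<k : j < k
      j<k = <-trans (n<1+n j) sj<k
      I≤cs : I ≤ cs
      I≤cs = lastTrue-≤ _ cs

    joinsAtStart : ∀ p → suc p ≡ I → x p ≤ y I × y p ≤ x I
    joinsAtStart p sp≡I = subst (λ q → x p ≤ y q) sp≡I (≤ᵇ-true⇒≤ (∧-conicalˡ _ _ joined))
                        , subst (λ q → y p ≤ x q) sp≡I (≤ᵇ-true⇒≤ (∧-conicalʳ _ _ joined))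
      where
      joined : joinable x y (suc p) ≡ true
      joined = subst (λ q → joinable x y q ≡ true) (sym sp≡I) (lastTrue-true (joinable x y) refl cs)

    tailSwappable : TailSwappable n cs I x y
    tailSwappable = record
      { x-mono  = λ b sb<n → rows-monotone j<k (n≤1+n b) sb<n
      ; y-mono  = λ b sb<n → rows-monotone sj<k (n≤1+n b) sb<n
      ; i≤cs    = I≤cs
      ; cs<n    = cs<n
      ; joins   = joinsAtStart
      ; crosses = λ p I≤p p<cs → crossing p (lastTrue-max (joinable x y) cs (s≤s I≤p) p<cs)
      ; agree   = λ p cs<p p<n → flat-after j<k sj<k cs<p p<n
      }
      where
      crossing : ∀ p → joinable x y (suc p) ≡ false → x (suc p) < y p ⊎ y (suc p) < x p
      crossing p notJoinable with x p ≤ᵇ y (suc p) in x≤y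
      ... | false = inj₂ (≤ᵇ-false⇒> x≤y)
      ... | true  = inj₁ (≤ᵇ-false⇒> notJoinable)

    Inv-tailSwap : Inv (tailSwap j T) + 𝟙 (y cs <ᵇ x cs) ≡ Inv T + 𝟙 (x cs <ᵇ y cs)
    Inv-tailSwap = Inv-tailTranspose j I cs sj<k T (tailSwap j T) (entry-tailSwap j sj<k T) tailSwappable

    admissible-tailSwap : Admissible cs (tailSwap j T)
    admissible-tailSwap = record { rows-monotone = monotone ; flat-after = flat }
      where
      monotone : ∀ {a} → a < k → Monotone< n (entry (tailSwap j T) a)
      monotone {a} a<k with transpose j a | transpose-view j a
      ... | _ | first = Monotone<-resp (tailSwap-first j sj<k T)
        (splice-monotone n I (rows-monotone j<k) (rows-monotone sj<k) (λ p sp≡I _ → proj₁ (joinsAtStart p sp≡I)))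
      ... | _ | second = Monotone<-resp (tailSwap-second j sj<k T)
        (splice-monotone n I (rows-monotone sj<k) (rows-monotone j<k) (λ p sp≡I _ → proj₂ (joinsAtStart p sp≡I)))
      ... | _ | fixed a≢j a≢sj = Monotone<-resp (tailSwap-other j sj<k T a≢j a≢sj) (rows-monotone a<k)
      flat : ∀ {a a′ p} → a < k → a′ < k → cs < p → p < n → entry (tailSwap j T) a p ≡ entry (tailSwap j T) a′ p
      flat {a} {a′} {p} a<k a′<k cs<p p<n rewrite entry-tailSwap j sj<k T a p | entry-tailSwap j sj<k T a′ p =
        flat-after (tailTranspose-< j I p sj<k a<k) (tailTranspose-< j I p sj<k a′<k) cs<p p<n

    start-tailSwap : start (tailSwap j T) j ≡ I
    start-tailSwap = lastTrue-unique _ cs I≤cs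
      (trans (rows≗ I) (joinable-splice I x y (≤-<-trans I≤cs cs<n) (rows-monotone j<k) (rows-monotone sj<k)))
      (λ q I<q q≤cs → trans (rows≗ q) (trans (joinable-splice-after I x y I<q) (lastTrue-max (joinable x y) cs I<q q≤cs)))
      where
      rows≗ : ∀ q → joinable (entry (tailSwap j T) j) (entry (tailSwap j T) (suc j)) q ≡ joinable (splice I x y) (splice I y x) q
      rows≗ = joinable-cong (tailSwap-first j sj<k T) (tailSwap-second j sj<k T)

    tailSwap-involutive : tailSwap j (tailSwap j T) ≡ T
    tailSwap-involutive = Tab-ext _ _ λ a b _ _ → begin
      entry (tailSwap j (tailSwap j T)) a b                       ≡⟨ entry-tailSwap j sj<k (tailSwap j T) a b ⟩
      entry (tailSwap j T) (tailTranspose j (start (tailSwap j T) j) a b) b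
                                                                  ≡⟨ cong (λ i → entry (tailSwap j T) (tailTranspose j i a b) b) start-tailSwap ⟩
      entry (tailSwap j T) (tailTranspose j I a b) b              ≡⟨ entry-tailSwap j sj<k T _ b ⟩
      entry T (tailTranspose j I (tailTranspose j I a b) b) b     ≡⟨ cong (λ a′ → entry T a′ b) (tailTranspose-involutive j I a b) ⟩
      entry T a b                                                 ∎
      where open ≡-Reasoning

    inD-tailSwap : ∀ {μ : List ℕ} {d : DiagonalVector n} → InD μ d T → InD μ d (tailSwap j T)
    inD-tailSwap {μ} {d} (((positive , _) , weight) , diagonal) = ((positive′ , monotone′) , weight′) , diagonal′
      where
      U : Tab k n
      U = tailSwap j T
      positive′ : ∀ r c → 1 ≤ label U r c
      positive′ r c rewrite label≡entry U r c | entry-tailSwap j sj<k T (toℕ r) (toℕ c)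
                          | entry≡label T (tailTranspose-< j I (toℕ c) sj<k (toℕ<n r)) (toℕ<n c) = positive _ _
      monotone′ : ∀ r (c c′ : Fin n) → toℕ c ≤ toℕ c′ → label U r c ≤ label U r c′
      monotone′ r c c′ c≤c′ rewrite label≡entry U r c | label≡entry U r c′ =
        Admissible.rows-monotone admissible-tailSwap (toℕ<n r) c≤c′ (toℕ<n c′)
      weight′ : HasWeight U μ
      weight′ i = begin
        countLabel U (suc i)                                                   ≡⟨ countLabel≡∑ U (suc i) ⟩
        ∑[ a < k ] ∑[ b < n ] 𝟙 (entry U a b ≡ᵇ suc i)                          ≡⟨ ∑<-cong k (λ a _ → ∑<-cong n (λ b _ → cong (λ v → 𝟙 (v ≡ᵇ suc i)) (entry-tailSwap j sj<k T a b))) ⟩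
        ∑[ a < k ] ∑[ b < n ] 𝟙 (entry T (tailTranspose j I a b) b ≡ᵇ suc i)    ≡⟨ ∑cells-tailTranspose k n j I sj<k (λ a b → 𝟙 (entry T a b ≡ᵇ suc i)) ⟩
        ∑[ a < k ] ∑[ b < n ] 𝟙 (entry T a b ≡ᵇ suc i)                          ≡⟨ countLabel≡∑ T (suc i) ⟨
        countLabel T (suc i)                                                   ≡⟨ weight i ⟩
        part μ i                                                               ∎
        where open ≡-Reasoning
      diagonal′ : HasDiag U d
      diagonal′ c = begin
        map (λ r → label U r c) (allFin k)                           ≡⟨ map-tabulate k (λ r → r) (λ r → label U r c) _ (λ r → trans (label≡entry U r c) (entry-tailSwap j sj<k T (toℕ r) (toℕ c))) ⟩
        applyUpTo (λ a → entry T (tailTranspose j I a (toℕ c)) (toℕ c)) k ↭⟨ applyUpTo-tailTranspose k n j I sj<k (toℕ c) (λ a → entry T a (toℕ c)) ⟩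
        applyUpTo (λ a → entry T a (toℕ c)) k                         ≡⟨ column≡applyUpTo T c ⟨
        map (λ r → label T r c) (allFin k)                            ↭⟨ diagonal c ⟩
        lookup d c                                                    ∎
        where open PermutationReasoning

module BubbleStep {k n : ℕ} (cs : ℕ) (cs<n : cs < n) (m : ℕ) where

  open TailSwap {k} {n} cs cs<n

  exactlyOneMin : Tab k n → ℕ → Bool
  exactlyOneMin T j = (entry T j cs ≡ᵇ m) xor (entry T (suc j) cs ≡ᵇ m)

  σ : ℕ → Tab k n → Tab k n
  σ j T = if exactlyOneMin T j then tailSwap j T else T

  module _ (j : ℕ) (sj<k : suc j < k) (T : Tab k n) where

    private
      x y : ℕ → ℕ
      x = entry T j
      y = entry T (suc j)
      I≤cs : start T j ≤ cs
      I≤cs = lastTrue-≤ _ cs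

    tailSwap-first-cs : entry (tailSwap j T) j cs ≡ y cs
    tailSwap-first-cs = trans (tailSwap-first j sj<k T cs) (splice-≥ (start T j) x y I≤cs)

    tailSwap-second-cs : entry (tailSwap j T) (suc j) cs ≡ x cs
    tailSwap-second-cs = trans (tailSwap-second j sj<k T cs) (splice-≥ (start T j) y x I≤cs)

    exactlyOneMin-tailSwap : exactlyOneMin (tailSwap j T) j ≡ exactlyOneMin T j
    exactlyOneMin-tailSwap rewrite tailSwap-first-cs | tailSwap-second-cs = xor-comm (y cs ≡ᵇ m) (x cs ≡ᵇ m)

    σ-idle : exactlyOneMin T j ≡ false → σ j T ≡ T
    σ-idle idle rewrite idle = refl

    σ-second-cs : exactlyOneMin T j ≡ true → entry (σ j T) (suc j) cs ≡ x cs
    σ-second-cs active rewrite active = tailSwap-second-cs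

    σ-other : ∀ {a} → a ≢ j → a ≢ suc j → ∀ b → entry (σ j T) a b ≡ entry T a b
    σ-other a≢j a≢sj b with exactlyOneMin T j
    ... | true  = tailSwap-other j sj<k T a≢j a≢sj b
    ... | false = refl

    module _ (A : Admissible cs T) where

      σ-involutive : σ j (σ j T) ≡ T
      σ-involutive with exactlyOneMin T j in active
      ... | false rewrite active = refl
      ... | true  rewrite exactlyOneMin-tailSwap | active = tailSwap-involutive j sj<k T A

      Inv-σ : exactlyOneMin T j ≡ true → Inv (σ j T) + 𝟙 (y cs <ᵇ x cs) ≡ Inv T + 𝟙 (x cs <ᵇ y cs)
      Inv-σ active rewrite active = Inv-tailSwap j sj<k T A

  inD-σ : ∀ {μ : List ℕ} {d : DiagonalVector n} j → suc j < k → (T : Tab k n) → Admissible cs T → InD μ d T → InD μ d (σ j T)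
  inD-σ {μ} {d} j sj<k T A T∈D with exactlyOneMin T j
  ... | true  = inD-tailSwap j sj<k T A {μ} {d} T∈D
  ... | false = T∈D

module Bubble {k n : ℕ} (cs : ℕ) (cs<n : cs < n) (m : ℕ) (μ : List ℕ) (d : DiagonalVector n)
              (admissible : (T : Tab k n) → InD μ d T → Admissible cs T)
              (minimal : (T : Tab k n) → InD μ d T → ∀ {a} → a < k → m ≤ entry T a cs) where

  open BubbleStep {k} {n} cs cs<n m

  isMin notMin : Tab k n → ℕ → ℕ
  isMin  T q = 𝟙 (entry T q cs ≡ᵇ m)
  notMin T q = 𝟙 (not (entry T q cs ≡ᵇ m))

  module _ (T : Tab k n) (q : ℕ) where

    isMin-≡ : entry T q cs ≡ m → isMin T q ≡ 1
    isMin-≡ refl = cong 𝟙 (≡ᵇ-refl m)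

    isMin-≢ : entry T q cs ≢ m → isMin T q ≡ 0
    isMin-≢ ≢m = cong 𝟙 (≡ᵇ-false ≢m)

    notMin-≡ : entry T q cs ≡ m → notMin T q ≡ 0
    notMin-≡ refl = cong (𝟙 ∘ not) (≡ᵇ-refl m)

    notMin-≢ : entry T q cs ≢ m → notMin T q ≡ 1
    notMin-≢ ≢m = cong (𝟙 ∘ not) (≡ᵇ-false ≢m)

  module _ (i : ℕ) (si<k : suc i < k) (U : Tab k n) (U∈D : InD μ d U) where

    private
      u v : ℕ
      u = entry U i cs
      v = entry U (suc i) cs

    σ-keeps : (u ≡ᵇ m) ≡ (v ≡ᵇ m) → σ i U ≡ U
    σ-keeps same = σ-idle i si<k U (trans (cong (_xor (v ≡ᵇ m)) same) (xor-same (v ≡ᵇ m)))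

    σ-sinks : u ≡ m → v ≢ m → Inv (σ i U) ≡ Inv U + 1 × entry (σ i U) (suc i) cs ≡ m
    σ-sinks u≡m v≢m = shift , trans (σ-second-cs i si<k U active) u≡m
      where
      active : exactlyOneMin U i ≡ true
      active rewrite u≡m | ≡ᵇ-refl m | ≡ᵇ-false v≢m = refl
      m<v : m < v
      m<v = ≤∧≢⇒< (minimal U U∈D si<k) (v≢m ∘ sym)
      shift : Inv (σ i U) ≡ Inv U + 1
      shift = begin
        Inv (σ i U)                  ≡⟨ +-identityʳ _ ⟨
        Inv (σ i U) + 0              ≡⟨ cong (Inv (σ i U) +_) (sym (𝟙<-zero (≤-trans (≤-reflexive u≡m) (<⇒≤ m<v)))) ⟩
        Inv (σ i U) + 𝟙 (v <ᵇ u)     ≡⟨ Inv-σ i si<k U (admissible U U∈D) active ⟩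
        Inv U + 𝟙 (u <ᵇ v)           ≡⟨ cong (Inv U +_) (𝟙<-one (subst (_< v) (sym u≡m) m<v)) ⟩
        Inv U + 1                    ∎
        where open ≡-Reasoning

    σ-lifts : u ≢ m → v ≡ m → Inv (σ i U) + 1 ≡ Inv U × entry (σ i U) (suc i) cs ≢ m
    σ-lifts u≢m v≡m = shift , u≢m ∘ trans (sym (σ-second-cs i si<k U active))
      where
      active : exactlyOneMin U i ≡ true
      active rewrite v≡m | ≡ᵇ-refl m | ≡ᵇ-false u≢m = refl
      m<u : m < u
      m<u = ≤∧≢⇒< (minimal U U∈D (<-trans (n<1+n i) si<k)) (u≢m ∘ sym)
      shift : Inv (σ i U) + 1 ≡ Inv U
      shift = begin
        Inv (σ i U) + 1              ≡⟨ cong (Inv (σ i U) +_) (𝟙<-one (subst (_< u) (sym v≡m) m<u)) ⟨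
        Inv (σ i U) + 𝟙 (v <ᵇ u)     ≡⟨ Inv-σ i si<k U (admissible U U∈D) active ⟩
        Inv U + 𝟙 (u <ᵇ v)           ≡⟨ cong (Inv U +_) (𝟙<-zero (≤-trans (≤-reflexive v≡m) (<⇒≤ m<u))) ⟩
        Inv U + 0                    ≡⟨ +-identityʳ _ ⟩
        Inv U                        ∎
        where open ≡-Reasoning

    σ-fromMin : u ≡ m → entry (σ i U) (suc i) cs ≡ m × Inv (σ i U) ≡ Inv U + notMin U (suc i)
    σ-fromMin u≡m with v ≟ m
    ... | no  v≢m = σ-sinks u≡m v≢m .proj₂ , trans (σ-sinks u≡m v≢m .proj₁) (cong (Inv U +_) (sym (notMin-≢ U (suc i) v≢m)))
    ... | yes v≡m = subst (λ V → entry V (suc i) cs ≡ m × Inv V ≡ Inv U + notMin U (suc i)) (sym keeps)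
                          (v≡m , trans (sym (+-identityʳ _)) (cong (Inv U +_) (sym (notMin-≡ U (suc i) v≡m))))
      where
      keeps : σ i U ≡ U
      keeps = σ-keeps (cong (_≡ᵇ m) (trans u≡m (sym v≡m)))

    σ-fromNonMin : u ≢ m → entry (σ i U) (suc i) cs ≢ m × Inv (σ i U) + isMin U (suc i) ≡ Inv U
    σ-fromNonMin u≢m with v ≟ m
    ... | yes v≡m = σ-lifts u≢m v≡m .proj₂ , trans (cong (Inv (σ i U) +_) (isMin-≡ U (suc i) v≡m)) (σ-lifts u≢m v≡m .proj₁)
    ... | no  v≢m = subst (λ V → entry V (suc i) cs ≢ m × Inv V + isMin U (suc i) ≡ Inv U) (sym keeps)
                          (v≢m , trans (cong (Inv U +_) (isMin-≢ U (suc i) v≢m)) (+-identityʳ _))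
      where
      keeps : σ i U ≡ U
      keeps = σ-keeps (trans (≡ᵇ-false u≢m) (sym (≡ᵇ-false v≢m)))

  bubble unbubble : ℕ → Tab k n → Tab k n
  bubble   zero    T = T
  bubble   (suc i) T = σ i (bubble i T)
  unbubble zero    T = T
  unbubble (suc i) T = unbubble i (σ i T)

  private
    σ∈D : ∀ i → suc i < k → ∀ T → InD μ d T → InD μ d (σ i T)
    σ∈D i si<k T T∈D = inD-σ {μ} {d} i si<k T (admissible T T∈D) T∈D

    σ-σ : ∀ i → suc i < k → ∀ T → InD μ d T → σ i (σ i T) ≡ T
    σ-σ i si<k T T∈D = σ-involutive i si<k T (admissible T T∈D)

  inD-bubble : ∀ i → i < k → ∀ T → InD μ d T → InD μ d (bubble i T)
  inD-bubble zero    _    T T∈D = T∈D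
  inD-bubble (suc i) si<k T T∈D = σ∈D i si<k (bubble i T) (inD-bubble i (<-trans (n<1+n i) si<k) T T∈D)

  inD-unbubble : ∀ i → i < k → ∀ T → InD μ d T → InD μ d (unbubble i T)
  inD-unbubble zero    _    T T∈D = T∈D
  inD-unbubble (suc i) si<k T T∈D = inD-unbubble i (<-trans (n<1+n i) si<k) _ (σ∈D i si<k T T∈D)

  unbubble-bubble : ∀ i → i < k → ∀ T → InD μ d T → unbubble i (bubble i T) ≡ T
  unbubble-bubble zero    _    T T∈D = refl
  unbubble-bubble (suc i) si<k T T∈D =
    trans (cong (unbubble i) (σ-σ i si<k _ (inD-bubble i i<k T T∈D))) (unbubble-bubble i i<k T T∈D)
    where
    i<k : i < k
    i<k = <-trans (n<1+n i) si<k

  bubble-unbubble : ∀ i → i < k → ∀ T → InD μ d T → bubble i (unbubble i T) ≡ T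
  bubble-unbubble zero    _    T T∈D = refl
  bubble-unbubble (suc i) si<k T T∈D =
    trans (cong (σ i) (bubble-unbubble i i<k _ (σ∈D i si<k T T∈D))) (σ-σ i si<k T T∈D)
    where
    i<k : i < k
    i<k = <-trans (n<1+n i) si<k

  bubble-below : ∀ i → i < k → ∀ T → ∀ {q} → i < q → entry (bubble i T) q cs ≡ entry T q cs
  bubble-below zero    _    T _    = refl
  bubble-below (suc i) si<k T si<q =
    trans (σ-other i si<k (bubble i T) (λ { refl → <-irrefl refl (<-trans (n<1+n i) si<q) }) (λ { refl → <-irrefl refl si<q }) cs)
          (bubble-below i (<-trans (n<1+n i) si<k) T (<-trans (n<1+n i) si<q))

  module _ (T : Tab k n) (T∈D : InD μ d T) where

    private
      bubble∈D : ∀ i → suc i < k → InD μ d (bubble i T)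
      bubble∈D i si<k = inD-bubble i (<-trans (n<1+n i) si<k) T T∈D

      next≡ : ∀ i → suc i < k → entry (bubble i T) (suc i) cs ≡ entry T (suc i) cs
      next≡ i si<k = bubble-below i (<-trans (n<1+n i) si<k) T (n<1+n i)

    Inv-bubble-fromMin : entry T 0 cs ≡ m → ∀ i → i < k →
      entry (bubble i T) i cs ≡ m × Inv (bubble i T) ≡ Inv T + ∑[ q < i ] notMin T (suc q)
    Inv-bubble-fromMin top≡m zero    _    = top≡m , sym (+-identityʳ _)
    Inv-bubble-fromMin top≡m (suc i) si<k =
      let u≡m , Inv≡ = Inv-bubble-fromMin top≡m i (<-trans (n<1+n i) si<k)
          v≡m , step = σ-fromMin i si<k (bubble i T) (bubble∈D i si<k) u≡m
      in v≡m , (begin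
        Inv (σ i (bubble i T))                                          ≡⟨ step ⟩
        Inv (bubble i T) + notMin (bubble i T) (suc i)                  ≡⟨ cong₂ _+_ Inv≡ (cong (λ v → 𝟙 (not (v ≡ᵇ m))) (next≡ i si<k)) ⟩
        Inv T + ∑[ q < i ] notMin T (suc q) + notMin T (suc i)          ≡⟨ +-assoc (Inv T) _ _ ⟩
        Inv T + (∑[ q < i ] notMin T (suc q) + notMin T (suc i))        ≡⟨ cong (Inv T +_) (∑<-init-last i (notMin T ∘ suc)) ⟨
        Inv T + ∑[ q < suc i ] notMin T (suc q)                         ∎)
      where open ≡-Reasoning

    Inv-bubble-fromNonMin : entry T 0 cs ≢ m → ∀ i → i < k →
      entry (bubble i T) i cs ≢ m × Inv (bubble i T) + ∑[ q < i ] isMin T (suc q) ≡ Inv T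
    Inv-bubble-fromNonMin top≢m zero    _    = top≢m , +-identityʳ _
    Inv-bubble-fromNonMin top≢m (suc i) si<k =
      let u≢m , Inv≡ = Inv-bubble-fromNonMin top≢m i (<-trans (n<1+n i) si<k)
          v≢m , step = σ-fromNonMin i si<k (bubble i T) (bubble∈D i si<k) u≢m
      in v≢m , (begin
        Inv (σ i (bubble i T)) + ∑[ q < suc i ] isMin T (suc q)            ≡⟨ cong (Inv (σ i (bubble i T)) +_) (∑<-init-last i (isMin T ∘ suc)) ⟩
        Inv (σ i (bubble i T)) + (∑[ q < i ] isMin T (suc q) + isMin T (suc i))
                                                                           ≡⟨ cong (λ t → Inv (σ i (bubble i T)) + (∑[ q < i ] isMin T (suc q) + t))
                                                                                   (cong (λ v → 𝟙 (v ≡ᵇ m)) (next≡ i si<k)) ⟨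
        Inv (σ i (bubble i T)) + (∑[ q < i ] isMin T (suc q) + isMin (bubble i T) (suc i))
                                                                           ≡⟨ cong (Inv (σ i (bubble i T)) +_) (+-comm _ (isMin (bubble i T) (suc i))) ⟩
        Inv (σ i (bubble i T)) + (isMin (bubble i T) (suc i) + ∑[ q < i ] isMin T (suc q))
                                                                           ≡⟨ +-assoc (Inv (σ i (bubble i T))) _ _ ⟨
        Inv (σ i (bubble i T)) + isMin (bubble i T) (suc i) + ∑[ q < i ] isMin T (suc q)
                                                                           ≡⟨ cong (_+ ∑[ q < i ] isMin T (suc q)) step ⟩
        Inv (bubble i T) + ∑[ q < i ] isMin T (suc q)                      ≡⟨ Inv≡ ⟩
        Inv T                                                              ∎)
      where open ≡-Reasoning

map-Unique-on : ∀ {A B : Set} (f : A → B) {xs : List A} → (∀ {x y} → x ∈ xs → y ∈ xs → f x ≡ f y → x ≡ y) →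
                Unique xs → Unique (map f xs)
map-Unique-on f {[]}     _   []          = []
map-Unique-on f {x ∷ xs} inj (x∉ ∷ uniq) =
  All.tabulate fresh ∷ map-Unique-on f (λ x∈ y∈ → inj (there x∈) (there y∈)) uniq
  where
  fresh : ∀ {z} → z ∈ map f xs → f x ≢ z
  fresh z∈ fx≡z with ∈-map⁻ f z∈
  ... | w , w∈ , refl = All.lookup x∉ w∈ (inj (here refl) (there w∈) fx≡z)

record Permutes {A : Set} (P : A → Set) (Φ : A → A) : Set where
  field
    inverse        : A → A
    Φ-closed       : ∀ {x} → P x → P (Φ x)
    inverse-closed : ∀ {x} → P x → P (inverse x)
    inverse-Φ      : ∀ {x} → P x → inverse (Φ x) ≡ x
    Φ-inverse      : ∀ {x} → P x → Φ (inverse x) ≡ x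

map-↭ : ∀ {A : Set} {P : A → Set} {Φ : A → A} {xs : List A} → Unique xs → (∀ x → (x ∈ xs) ⇔ P x) →
        Permutes P Φ → map Φ xs ↭ xs
map-↭ {P = P} {Φ} {xs} unique xs≡P perm =
  ∼bag⇒↭ (unique∧set⇒bag (map-Unique-on Φ injective unique) unique (mk⇔ into onto))
  where
  open Permutes perm
  open Equivalence
  injective : ∀ {x y} → x ∈ xs → y ∈ xs → Φ x ≡ Φ y → x ≡ y
  injective x∈ y∈ Φx≡Φy = trans (sym (inverse-Φ (to (xs≡P _) x∈))) (trans (cong inverse Φx≡Φy) (inverse-Φ (to (xs≡P _) y∈)))
  into : ∀ {z} → z ∈ map Φ xs → z ∈ xs
  into z∈ with ∈-map⁻ Φ z∈
  ... | w , w∈ , refl = from (xs≡P _) (Φ-closed (to (xs≡P w) w∈))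
  onto : ∀ {z} → z ∈ xs → z ∈ map Φ xs
  onto {z} z∈ = subst (_∈ map Φ xs) (Φ-inverse (to (xs≡P z) z∈)) (∈-map⁺ Φ (from (xs≡P _) (inverse-closed (to (xs≡P z) z∈))))

module _ {c ℓ : Level} (R : CommutativeRing c ℓ) where

  open CommutativeRing R
    renaming ( _+_ to _+ᴿ_; _*_ to _*ᴿ_; +-assoc to +ᴿ-assoc; +-comm to +ᴿ-comm; +-identityʳ to +ᴿ-identityʳ
             ; refl to ≈-refl; sym to ≈-sym; trans to ≈-trans; reflexive to ≈-reflexive)
  open import Relation.Binary.Reasoning.Setoid setoid
  open import Algebra.Properties.Ring ring using (-1*x≈-x)

  pow-+ : ∀ x a b → pow R x (a + b) ≈ pow R x a *ᴿ pow R x b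
  pow-+ x zero    b = ≈-sym (*-identityˡ _)
  pow-+ x (suc a) b = begin
    x *ᴿ pow R x (a + b)              ≈⟨ *-congˡ (pow-+ x a b) ⟩
    x *ᴿ (pow R x a *ᴿ pow R x b)     ≈⟨ *-assoc _ _ _ ⟨
    x *ᴿ pow R x a *ᴿ pow R x b       ∎

  pow-shift : ∀ {ζ k o z e e′} → pow R ζ k ≈ 1# → o + z ≡ k → e ≡ e′ + o ⊎ e + z ≡ e′ →
              pow R ζ e ≈ pow R ζ o *ᴿ pow R ζ e′
  pow-shift {ζ} {k} {o} {z} {e} {e′} ζᵏ≈1 o+z≡k (inj₁ refl) = ≈-trans (pow-+ ζ e′ o) (*-comm _ _)
  pow-shift {ζ} {k} {o} {z} {e} {e′} ζᵏ≈1 o+z≡k (inj₂ refl) = ≈-sym (begin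
    pow R ζ o *ᴿ pow R ζ (e + z)               ≈⟨ *-congˡ (pow-+ ζ e z) ⟩
    pow R ζ o *ᴿ (pow R ζ e *ᴿ pow R ζ z)      ≈⟨ x∙yz≈y∙xz (pow R ζ o) _ _ ⟩
    pow R ζ e *ᴿ (pow R ζ o *ᴿ pow R ζ z)      ≈⟨ *-congˡ (pow-+ ζ o z) ⟨
    pow R ζ e *ᴿ pow R ζ (o + z)               ≈⟨ *-congˡ (≈-reflexive (cong (pow R ζ) o+z≡k)) ⟩
    pow R ζ e *ᴿ pow R ζ k                     ≈⟨ *-congˡ ζᵏ≈1 ⟩
    pow R ζ e *ᴿ 1#                            ≈⟨ *-identityʳ _ ⟩
    pow R ζ e                                  ∎)
    where open import Algebra.Properties.CommutativeSemigroup *-commutativeSemigroup using (x∙yz≈y∙xz)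

  module _ {k n : ℕ} (ζ : Carrier) where

    invSum-↭ : {xs ys : List (Tab k n)} → xs ↭ ys → invSum R ζ xs ≈ invSum R ζ ys
    invSum-↭ ↭.refl = ≈-refl
    invSum-↭ (prep x xs↭ys) = +-congˡ (invSum-↭ xs↭ys)
    invSum-↭ (swap {xs = xs} {ys = ys} x y xs↭ys) = begin
      pow R ζ (Inv x) +ᴿ (pow R ζ (Inv y) +ᴿ invSum R ζ xs)    ≈⟨ +ᴿ-assoc _ _ _ ⟨
      (pow R ζ (Inv x) +ᴿ pow R ζ (Inv y)) +ᴿ invSum R ζ xs    ≈⟨ +-cong (+ᴿ-comm _ _) (invSum-↭ xs↭ys) ⟩
      (pow R ζ (Inv y) +ᴿ pow R ζ (Inv x)) +ᴿ invSum R ζ ys    ≈⟨ +ᴿ-assoc _ _ _ ⟩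
      pow R ζ (Inv y) +ᴿ (pow R ζ (Inv x) +ᴿ invSum R ζ ys)    ∎
    invSum-↭ (↭.trans xs↭ys ys↭zs) = ≈-trans (invSum-↭ xs↭ys) (invSum-↭ ys↭zs)

    invSum-map : ∀ (f : Tab k n → Tab k n) a xs → (∀ {T} → T ∈ xs → pow R ζ (Inv (f T)) ≈ a *ᴿ pow R ζ (Inv T)) →
                 invSum R ζ (map f xs) ≈ a *ᴿ invSum R ζ xs
    invSum-map f a []       _     = ≈-sym (zeroʳ a)
    invSum-map f a (T ∷ Ts) scale = begin
      pow R ζ (Inv (f T)) +ᴿ invSum R ζ (map f Ts)    ≈⟨ +-cong (scale (here refl)) (invSum-map f a Ts (scale ∘ there)) ⟩
      a *ᴿ pow R ζ (Inv T) +ᴿ a *ᴿ invSum R ζ Ts      ≈⟨ distribˡ a _ _ ⟨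
      a *ᴿ (pow R ζ (Inv T) +ᴿ invSum R ζ Ts)         ∎

  fixed-by-non-one⇒0 : IsIntegralDomain R → ∀ {a s} → ¬ (a ≈ 1#) → s ≈ a *ᴿ s → s ≈ 0#
  fixed-by-non-one⇒0 (_ , noZeroDivisors) {a} {s} a≉1 s≈as with noZeroDivisors (a - 1#) s (begin
      (a +ᴿ - 1#) *ᴿ s           ≈⟨ distribʳ s a (- 1#) ⟩
      a *ᴿ s +ᴿ - 1# *ᴿ s        ≈⟨ +-cong (≈-sym s≈as) (-1*x≈-x s) ⟩
      s +ᴿ - s                   ≈⟨ -‿inverseʳ s ⟩
      0#                         ∎)
  ... | inj₂ s≈0   = s≈0
  ... | inj₁ a-1≈0 = ⊥-elim (a≉1 (begin
      a                          ≈⟨ +ᴿ-identityʳ a ⟨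
      a +ᴿ 0#                    ≈⟨ +-congˡ (-‿inverseˡ 1#) ⟨
      a +ᴿ (- 1# +ᴿ 1#)          ≈⟨ +ᴿ-assoc _ _ _ ⟨
      (a +ᴿ - 1#) +ᴿ 1#          ≈⟨ +-congʳ a-1≈0 ⟩
      0# +ᴿ 1#                   ≈⟨ +-identityˡ 1# ⟩
      1#                         ∎))

  invSum-vanishes : ∀ {k n} → IsIntegralDomain R → (ζ : Carrier) {P : Tab k n → Set} (L : List (Tab k n)) →
    Unique L → (∀ T → (T ∈ L) ⇔ P T) → ∀ {Φ} → Permutes P Φ → ∀ {a} → ¬ (a ≈ 1#) →
    (∀ {T} → P T → pow R ζ (Inv (Φ T)) ≈ a *ᴿ pow R ζ (Inv T)) → invSum R ζ L ≈ 0#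
  invSum-vanishes domain ζ L unique L≡P {Φ} perm {a} a≉1 scale = fixed-by-non-one⇒0 domain a≉1 (begin
    invSum R ζ L              ≈⟨ invSum-↭ ζ (map-↭ unique L≡P perm) ⟨
    invSum R ζ (map Φ L)      ≈⟨ invSum-map ζ Φ a L (λ T∈ → scale (Equivalence.to (L≡P _) T∈)) ⟩
    a *ᴿ invSum R ζ L         ∎)

lastTrueBelow : (f : ℕ → Bool) → ∀ p →
  (∀ c → c < p → f c ≡ false) ⊎ ∃[ c ] c < p × f c ≡ true × (∀ q → c < q → q < p → f q ≡ false)
lastTrueBelow f zero = inj₁ (λ _ ())
lastTrueBelow f (suc p) with f p in fp
... | true  = inj₂ (p , ≤-refl , fp , λ q p<q q<sp → ⊥-elim (<⇒≱ p<q (≤-pred q<sp)))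
... | false = Sum.map (λ none c c<sp → extend c c<sp (none c))
                      (λ (c , c<p , fc , later) → c , m<n⇒m<1+n c<p , fc , λ q c<q q<sp → extend q q<sp (later q c<q))
                      (lastTrueBelow f p)
  where
  extend : ∀ q → q < suc p → (q < p → f q ≡ false) → f q ≡ false
  extend q q<sp below with q ≟ p
  ... | yes refl = fp
  ... | no  q≢p  = below (≤∧≢⇒< (≤-pred q<sp) q≢p)

module _ {k n : ℕ} {μ : List ℕ} {d : DiagonalVector n} {T U : Tab k n} (T∈D : InD μ d T) (U∈D : InD μ d U) where

  column-↭ : ∀ {c} → c < n → applyUpTo (λ a → entry T a c) k ↭ applyUpTo (λ a → entry U a c) k
  column-↭ {c} c<n = begin
    applyUpTo (λ a → entry T a c) k              ≡⟨ cong (λ c′ → applyUpTo (λ a → entry T a c′) k) (toℕ-fromℕ< c<n) ⟨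
    applyUpTo (λ a → entry T a (toℕ c′)) k       ≡⟨ column≡applyUpTo T c′ ⟨
    map (λ r → label T r c′) (allFin k)          ↭⟨ proj₂ T∈D c′ ⟩
    lookup d c′                                  ↭⟨ proj₂ U∈D c′ ⟨
    map (λ r → label U r c′) (allFin k)          ≡⟨ column≡applyUpTo U c′ ⟩
    applyUpTo (λ a → entry U a (toℕ c′)) k       ≡⟨ cong (λ c′ → applyUpTo (λ a → entry U a c′) k) (toℕ-fromℕ< c<n) ⟩
    applyUpTo (λ a → entry U a c) k              ∎
    where
    open PermutationReasoning
    c′ : Fin n
    c′ = fromℕ< c<n

  entry∈column : ∀ {a c} → a < k → c < n → ∃[ a′ ] a′ < k × entry T a c ≡ entry U a′ c
  entry∈column a<k c<n = ∈-applyUpTo⁻ _ (↭ₚ.∈-resp-↭ (column-↭ c<n) (∈-applyUpTo⁺ _ a<k))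

  ∑column-invariant : ∀ (h : ℕ → ℕ) {c} → c < n → ∑[ a < k ] h (entry T a c) ≡ ∑[ a < k ] h (entry U a c)
  ∑column-invariant h {c} c<n = begin
    sum (applyUpTo (λ a → h (entry T a c)) k)          ≡⟨ cong sum (map-applyUpTo _ h k) ⟨
    sum (map h (applyUpTo (λ a → entry T a c) k))      ≡⟨ sum-↭ (↭ₚ.map⁺ h (column-↭ c<n)) ⟩
    sum (map h (applyUpTo (λ a → entry U a c) k))      ≡⟨ cong sum (map-applyUpTo _ h k) ⟩
    sum (applyUpTo (λ a → h (entry U a c)) k)          ∎
    where open ≡-Reasoning

minimum-attained : ∀ (f : ℕ → ℕ) k → ∃[ m ] (∀ {a} → a < suc k → m ≤ f a) × ∃[ a ] a < suc k × f a ≡ m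
minimum-attained f k = m , (λ a<sk → All.lookup (min≤xs (f 0) _) (∈-applyUpTo⁺ f a<sk)) , attained
  where
  m : ℕ
  m = min (f 0) (applyUpTo f (suc k))
  attained : ∃[ a ] a < suc k × f a ≡ m
  attained with argmin-sel (λ v → v) (f 0) (applyUpTo f (suc k))
  ... | inj₁ m≡f0 = 0 , z<s , sym m≡f0
  ... | inj₂ m∈   = let a , a<sk , m≡fa = ∈-applyUpTo⁻ f m∈ in a , a<sk , sym m≡fa

record InvShift {k n : ℕ} (D : Tab k n → Set) : Set where
  field
    Φ        : Tab k n → Tab k n
    permutes : Permutes D Φ
    up down  : ℕ
    up>0     : 0 < up
    down>0   : 0 < down
    up+down  : up + down ≡ k
    shift    : ∀ {T} → D T → Inv (Φ T) ≡ Inv T + up ⊎ Inv (Φ T) + down ≡ Inv T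

module _ {k′ n : ℕ} {μ : List ℕ} {d : DiagonalVector n} {T₀ : Tab (suc k′) n} (T₀∈D : InD μ d T₀) where

  private
    k = suc k′

  nonConstantCount : ℕ → ℕ
  nonConstantCount c = ∑[ a < k ] 𝟙 (not (entry T₀ a c ≡ᵇ entry T₀ 0 c))

  constant-column : ∀ {c} → nonConstantCount c ≡ 0 → ∀ {a} → a < k → entry T₀ a c ≡ entry T₀ 0 c
  constant-column {c} count≡0 {a} a<k with entry T₀ a c ≟ entry T₀ 0 c
  ... | yes same = same
  ... | no  diff = ⊥-elim (1+n≢0 (trans (cong (𝟙 ∘ not) (sym (≡ᵇ-false diff)))
                                        (∑<-zero⇒ k (λ a → 𝟙 (not (entry T₀ a c ≡ᵇ entry T₀ 0 c))) count≡0 a<k)))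

  constant-columns⇒unique : (∀ c → c < n → nonConstantCount c ≡ 0) → ∀ {U} → InD μ d U → U ≡ T₀
  constant-columns⇒unique constant {U} U∈D = Tab-ext U T₀ λ a c a<k c<n →
    let a′ , a′<k , U≡T₀ = entry∈column {μ = μ} {d = d} {T = U} {U = T₀} U∈D T₀∈D a<k c<n
    in trans U≡T₀ (trans (constant-column (constant c c<n) a′<k) (sym (constant-column (constant c c<n) a<k)))

  module _ (cs : ℕ) (cs<n : cs < n) (nonConstant : 0 < nonConstantCount cs)
           (constantAfter : ∀ q → cs < q → q < n → nonConstantCount q ≡ 0)
           (columnMin : ℕ) (columnMin-≤ : ∀ {a} → a < k → columnMin ≤ entry T₀ a cs)
           (columnMin-attained : ∃[ a ] a < k × entry T₀ a cs ≡ columnMin) where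

    admissible : ∀ U → InD μ d U → Admissible cs U
    admissible U U∈D@(((_ , increasing) , _) , _) = record { rows-monotone = monotone ; flat-after = flat }
      where
      monotone : ∀ {a} → a < k → Monotone< n (entry U a)
      monotone a<k {b} {b′} b≤b′ b′<n
        rewrite entry≡label U a<k (≤-<-trans b≤b′ b′<n) | entry≡label U a<k b′<n =
        increasing _ _ _ (subst₂ _≤_ (sym (toℕ-fromℕ< _)) (sym (toℕ-fromℕ< b′<n)) b≤b′)
      toT₀ : ∀ {a p} → a < k → cs < p → p < n → entry U a p ≡ entry T₀ 0 p
      toT₀ a<k cs<p p<n =
        let a′ , a′<k , U≡T₀ = entry∈column {μ = μ} {d = d} {T = U} {U = T₀} U∈D T₀∈D a<k p<n
        in trans U≡T₀ (constant-column (constantAfter _ cs<p p<n) a′<k)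
      flat : ∀ {a a′ p} → a < k → a′ < k → cs < p → p < n → entry U a p ≡ entry U a′ p
      flat a<k a′<k cs<p p<n = trans (toT₀ a<k cs<p p<n) (sym (toT₀ a′<k cs<p p<n))

    minimal : ∀ U → InD μ d U → ∀ {a} → a < k → columnMin ≤ entry U a cs
    minimal U U∈D a<k =
      let a′ , a′<k , U≡T₀ = entry∈column {μ = μ} {d = d} {T = U} {U = T₀} U∈D T₀∈D a<k cs<n
      in subst (columnMin ≤_) (sym U≡T₀) (columnMin-≤ a′<k)

    open Bubble cs cs<n columnMin μ d admissible minimal

    private
      up down : Tab k n → ℕ
      up   T = ∑< k (notMin T)
      down T = ∑< k (isMin T)

      up-invariant : ∀ {T} → InD μ d T → up T ≡ up T₀
      up-invariant {T} T∈D = ∑column-invariant {μ = μ} {d = d} {T = T} {U = T₀} T∈D T₀∈D (λ v → 𝟙 (not (v ≡ᵇ columnMin))) cs<n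

      down-invariant : ∀ {T} → InD μ d T → down T ≡ down T₀
      down-invariant {T} T∈D = ∑column-invariant {μ = μ} {d = d} {T = T} {U = T₀} T∈D T₀∈D (λ v → 𝟙 (v ≡ᵇ columnMin)) cs<n

      up+down : up T₀ + down T₀ ≡ k
      up+down = trans (sym (∑<-distrib-+ k (notMin T₀) (isMin T₀))) (trans (∑<-cong k (λ a _ → split a)) (∑<-one k))
        where
        split : ∀ a → notMin T₀ a + isMin T₀ a ≡ 1
        split a with entry T₀ a cs ≡ᵇ columnMin
        ... | true  = refl
        ... | false = refl

      down>0 : 0 < down T₀
      down>0 = let a , a<k , top≡min = columnMin-attained in
        <-≤-trans (s≤s z≤n) (subst (_≤ down T₀) (isMin-≡ T₀ a top≡min) (∑<-term-≤ k (isMin T₀) a<k))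

      counted : ∀ {a} → a < k → entry T₀ a cs ≢ columnMin → 0 < up T₀
      counted {a} a<k a≢min = <-≤-trans (s≤s z≤n) (subst (_≤ up T₀) (notMin-≢ T₀ a a≢min) (∑<-term-≤ k (notMin T₀) a<k))

      up>0 : 0 < up T₀
      up>0 with ∑<-pos⇒ k (λ a → 𝟙 (not (entry T₀ a cs ≡ᵇ entry T₀ 0 cs))) nonConstant
      ... | a , a<k , differs with entry T₀ a cs ≟ columnMin | entry T₀ 0 cs ≟ columnMin
      ...   | no  a≢min | _         = counted a<k a≢min
      ...   | yes _     | no  0≢min = counted z<s 0≢min
      ...   | yes a≡min | yes 0≡min =
        ⊥-elim (<-irrefl refl (subst (λ b → 0 < 𝟙 (not b)) (≡ᵇ-true (trans a≡min (sym 0≡min))) differs))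

    Inv-bubble-shift : ∀ {T} → InD μ d T → Inv (bubble k′ T) ≡ Inv T + up T₀ ⊎ Inv (bubble k′ T) + down T₀ ≡ Inv T
    Inv-bubble-shift {T} T∈D with entry T 0 cs ≟ columnMin
    ... | yes top≡min = inj₁ (trans (proj₂ (Inv-bubble-fromMin T T∈D top≡min k′ (n<1+n k′))) (cong (Inv T +_) up≡))
      where
      up≡ : ∑[ q < k′ ] notMin T (suc q) ≡ up T₀
      up≡ = trans (cong (_+ ∑[ q < k′ ] notMin T (suc q)) (sym (notMin-≡ T 0 top≡min))) (up-invariant {T} T∈D)
    ... | no  top≢min = inj₂ (trans (cong (Inv (bubble k′ T) +_) down≡) (proj₂ (Inv-bubble-fromNonMin T T∈D top≢min k′ (n<1+n k′))))
      where
      down≡ : down T₀ ≡ ∑[ q < k′ ] isMin T (suc q)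
      down≡ = trans (sym (down-invariant {T} T∈D)) (cong (_+ ∑[ q < k′ ] isMin T (suc q)) (isMin-≢ T 0 top≢min))

    invShift : InvShift (InD μ d)
    invShift = record
      { Φ        = bubble k′
      ; permutes = record
        { inverse        = unbubble k′
        ; Φ-closed       = inD-bubble k′ (n<1+n k′) _
        ; inverse-closed = inD-unbubble k′ (n<1+n k′) _
        ; inverse-Φ      = unbubble-bubble k′ (n<1+n k′) _
        ; Φ-inverse      = bubble-unbubble k′ (n<1+n k′) _
        }
      ; up       = up T₀
      ; down     = down T₀
      ; up>0     = up>0
      ; down>0   = down>0
      ; up+down  = up+down
      ; shift    = Inv-bubble-shift
      }

  distinct⇒invShift : ∀ {T₁} → InD μ d T₁ → T₁ ≢ T₀ → InvShift (InD μ d)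
  distinct⇒invShift T₁∈D T₁≢T₀ with lastTrueBelow (λ c → 0 <ᵇ nonConstantCount c) n
  ... | inj₁ none = ⊥-elim (T₁≢T₀ (constant-columns⇒unique (λ c c<n → n≤0⇒n≡0 (<ᵇ-false⇒≥ (none c c<n))) T₁∈D))
  ... | inj₂ (cs , cs<n , nonConstant , after) =
    let m , m≤ , m-attained = minimum-attained (λ a → entry T₀ a cs) k′ in
    invShift cs cs<n (<ᵇ-true⇒< nonConstant) (λ q cs<q q<n → n≤0⇒n≡0 (<ᵇ-false⇒≥ (after q cs<q q<n))) m m≤ m-attained

proposition4 : {c ℓ : Level} (R : CommutativeRing c ℓ) → IsIntegralDomain R →
    (n k : ℕ) → 0 < n → 0 < k →
    (μ : List ℕ) → IsPartition μ (k * n) →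
    (d : DiagonalVector n) →
    (L : List (Tab k n)) → Unique L → (∀ T → (T ∈ L) ⇔ InD μ d T) →
    2 ≤ length L →
    (ζ : CommutativeRing.Carrier R) → IsPrimitiveRoot R k ζ →
    CommutativeRing._≈_ R (invSum R ζ L) (CommutativeRing.0# R)
proposition4 _ _ _ zero    _ () _ _ _ _          _ _ _        _ _
proposition4 _ _ _ (suc _) _ _  _ _ _ []         _ _ ()       _ _
proposition4 _ _ _ (suc _) _ _  _ _ _ (_ ∷ [])   _ _ (s≤s ()) _ _
proposition4 R domain n (suc k′) _ _ μ _ d L@(T₀ ∷ T₁ ∷ _) unique@((T₀≢T₁ ∷ _) ∷ _) L≡D _ ζ (ζᵏ≈1 , ζʲ≉1) =
  invSum-vanishes R domain ζ L unique L≡D permutes (ζʲ≉1 up up>0 (subst (up <_) up+down (m<m+n up down>0)))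
                  (λ {T} T∈D → pow-shift R {ζ} {suc k′} {up} {down} {Inv (Φ T)} {Inv T} ζᵏ≈1 up+down (shift T∈D))
  where
  open InvShift (distinct⇒invShift {μ = μ} {d = d} (Equivalence.to (L≡D T₀) (here refl))
                                   (Equivalence.to (L≡D T₁) (there (here refl))) (T₀≢T₁ ∘ sym))
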